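{- Let $\lambda_1,\lambda_2,u,v\in\mathbb{Z}$ with $\gcd(u,v)=1$ and $v\mid(\lambda_1-\lambda_2)$, let $\Lambda=\operatorname{diag}(\lambda_1,\lambda_2)$, $M=\begin{pmatrix}1&u\\0&v\end{pmatrix}$, and assume $A=M\Lambda M^{ -1}\in\operatorname{M}_2(\mathbb{Z})$ is non-singular with $\mathcal{P}'\ne\emptyset$. Assume $\operatorname{rad}(\lambda_1)$ does not divide $\operatorname{rad}(\lambda_2)$ and $\operatorname{rad}(\lambda_2)$ does not divide $\operatorname{rad}(\lambda_1)$. Then $T\in\operatorname{End}(G_A)$ if and only if $T=MXM^{ -1}$ with $X=\operatorname{diag}(x_1,x_2)$, where $x_i\in\mathbb{Z}[\lambda_i^{ -1}]$ for $i=1,2$ and $\frac{x_1-x_2}{v}\in\mathcal{R}$. In particular, $\operatorname{End}(G_A)$ is commutative, isomorphic to a subring of $\mathbb{Z}[\lambda_1^{ -1}]\times\mathbb{Z}[\lambda_2^{ -1}]$, and lies inside the centralizer of $A$ in $\operatorname{M}_2(\mathcal{R})$.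
   Context: $G_A=\{A^k\mathbf{x}\mid\mathbf{x}\in\mathbb{Z}^2,k\in\mathbb{Z}\}\subseteq\mathbb{Q}^2$; every group endomorphism of $G_A$ is given by a matrix in $\operatorname{M}_2(\mathbb{Q})$, and $\operatorname{End}(G_A)$ is identified with the set of $T\in\operatorname{M}_2(\mathbb{Q})$ with $T(G_A)\subseteq G_A$. $\mathcal{R}=\mathbb{Z}[1/\det A]$. $\mathcal{P}$ is the set of primes dividing $\det A$, $\mathcal{P}'=\{p\in\mathcal{P}\mid h_A\not\equiv x^2\pmod p\}$ with $h_A$ the characteristic polynomial of $A$. For a nonzero integer $m\ne\pm1$, $\operatorname{rad}(m)$ is the product of the distinct primes dividing $m$. $\mathbb{Z}[\lambda^{ -1}]\subseteq\mathbb{Q}$ is the ring generated by $1/\lambda$. -}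

module Defs where

open import Data.Nat as ℕ using (ℕ; zero; suc)
open import Data.Nat.Primality using (Prime; prime?)
open import Data.Nat.Divisibility using (_∣?_)
open import Data.Integer as ℤ using (ℤ; +_; -[1+_])
open import Data.Integer.Divisibility as ℤD using ()
open import Data.Rational as ℚ using (ℚ; 0ℚ; 1ℚ; _+_; _*_; _-_; -_)
open import Data.Rational.Properties using (_≟_)
open import Data.Fin using (Fin; zero; suc)
open import Data.List using (List; filter; upTo)
open import Data.Nat.ListAction using (product)
open import Data.Product using (Σ; ∃; _×_; _,_; proj₁; proj₂)
open import Relation.Nullary using (¬_; yes; no)
open import Relation.Nullary.Decidable using (_×-dec_)
open import Relation.Binary.PropositionalEquality using (_≡_)

ι : ℤ → ℚ
ι z = z ℚ./ 1

-- total multiplicative inverse on ℚ (only ever applied to nonzero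
-- arguments in the statement; the value at 0 is an irrelevant convention)
inv : ℚ → ℚ
inv q with q ≟ 0ℚ
... | yes _  = 0ℚ
... | no q≢0 = ℚ.1/_ q {{ℚ.≢-nonZero q≢0}}

_^ℚ_ : ℚ → ℕ → ℚ
q ^ℚ zero  = 1ℚ
q ^ℚ suc n = q * (q ^ℚ n)

Zinv : ℤ → ℚ → Set
Zinv l q = ∃ λ (a : ℤ) → ∃ λ (n : ℕ) → q ≡ ι a * (inv (ι l) ^ℚ n)

record M2 (R : Set) : Set where
  constructor mat
  field
    a b c d : R
open M2 public

mapM : {R S : Set} → (R → S) → M2 R → M2 S
mapM f (mat a b c d) = mat (f a) (f b) (f c) (f d)

V2 : Set
V2 = ℚ × ℚ

infixl 7 _·_
infixl 6 _⊕_
infixr 5 _▹_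

_·_ : M2 ℚ → M2 ℚ → M2 ℚ
mat a b c d · mat a' b' c' d' =
  mat (a * a' + b * c') (a * b' + b * d') (c * a' + d * c') (c * b' + d * d')

_⊕_ : M2 ℚ → M2 ℚ → M2 ℚ
mat a b c d ⊕ mat a' b' c' d' = mat (a + a') (b + b') (c + c') (d + d')

_▹_ : M2 ℚ → V2 → V2
mat a b c d ▹ (x , y) = (a * x + b * y , c * x + d * y)

I₂ : M2 ℚ
I₂ = mat 1ℚ 0ℚ 0ℚ 1ℚ

diag : ℚ → ℚ → M2 ℚ
diag x y = mat x 0ℚ 0ℚ y

det : M2 ℚ → ℚ
det (mat a b c d) = a * d - b * c

-- inverse via the adjugate (meaningful when det ≠ 0)
inverse : M2 ℚ → M2 ℚ
inverse m@(mat a b c d) = let δ = inv (det m) in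
  mat (δ * d) (δ * (- b)) (δ * (- c)) (δ * a)

_^M_ : M2 ℚ → ℕ → M2 ℚ
m ^M zero  = I₂
m ^M suc n = m · (m ^M n)

_^Mℤ_ : M2 ℚ → ℤ → M2 ℚ
m ^Mℤ (+ n)    = m ^M n
m ^Mℤ -[1+ n ] = inverse m ^M suc n

Mmat : ℤ → ℤ → M2 ℚ
Mmat u v = mat 1ℚ (ι u) 0ℚ (ι v)

detℤ : M2 ℤ → ℤ
detℤ (mat a b c d) = a ℤ.* d ℤ.- b ℤ.* c

traceℤ : M2 ℤ → ℤ
traceℤ (mat a b c d) = a ℤ.+ d

InG : M2 ℤ → V2 → Set
InG A y = ∃ λ (k : ℤ) → ∃ λ (x : ℤ × ℤ) →
  y ≡ (mapM ι A ^Mℤ k) ▹ (ι (proj₁ x) , ι (proj₂ x))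

IsEnd : M2 ℤ → M2 ℚ → Set
IsEnd A T = ∀ y → InG A y → InG A (T ▹ y)

InR : M2 ℤ → ℚ → Set
InR A = Zinv (detℤ A)

-- polynomials of degree ≤ 2 as coefficient vectors (index i ↦ coeff of x^i)
Poly2 : Set
Poly2 = Fin 3 → ℤ

charPoly : M2 ℤ → Poly2
charPoly A zero             = detℤ A
charPoly A (suc zero)       = ℤ.- traceℤ A
charPoly A (suc (suc zero)) = + 1

xSq : Poly2
xSq zero             = + 0
xSq (suc zero)       = + 0
xSq (suc (suc zero)) = + 1

PolyCong : ℕ → Poly2 → Poly2 → Set
PolyCong p f g = ∀ i → (+ p) ℤD.∣ (f i ℤ.- g i)

InP' : M2 ℤ → ℕ → Set
InP' A p = Prime p × ((+ p) ℤD.∣ detℤ A) × ¬ PolyCong p (charPoly A) xSq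

rad : ℤ → ℕ
rad m = product (filter (λ p → prime? p ×-dec (p ∣? ℤ.∣ m ∣)) (upTo (suc ℤ.∣ m ∣)))

-- Conjugating by M turns A into Λ = diag(l₁, l₂), and since AⁿM = MΛⁿ, the group M⁻¹G_A consists of
-- the z ∈ ℚ² with MΛⁿz ∈ ℤ² for some n; T is an endomorphism iff X = M⁻¹TM preserves this set.
-- Testing X on (l₁⁻ᵏ, 0) and (0, l₂⁻ᵏ) for all k shows that its off-diagonal entries are divisible by
-- every power of a prime dividing one eigenvalue but not the other, so X is diagonal, X = diag(x₁, x₂).
-- Since MΛᴷ⁺ⁿXz = M·diag(l₁ᴷx₁, l₂ᴷx₂)·M⁻¹ · MΛⁿz and M·diag(P, Q)·M⁻¹ = (P, u(Q − P)/v; 0, Q),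
-- X acts iff for some K the numbers l₁ᴷx₁, l₂ᴷx₂ are integers congruent mod v (gcd(u, v) = 1 is what
-- lets one read the congruence off the corner entry). As l₁ ≡ l₂ (mod v), this is equivalent to
-- xᵢ ∈ ℤ[1/lᵢ] and (x₁ − x₂)/v ∈ ℤ[1/(l₁l₂)]. Every endomorphism is thus the upper triangular matrix
-- (x₁, u(x₂ − x₁)/v; 0, x₂), and the remaining claims are computations with such matrices.

module Submission where

open import Defs
import Data.Nat as ℕ
open ℕ using (ℕ; zero; suc; _<_)
import Data.Nat.Properties as ℕP
import Data.Nat.Divisibility as ℕD
open ℕD using (_∣_; _∣?_; divides)
open import Data.Nat.Primality using (Prime; prime?; euclidsLemma; prime⇒irreducible; prime⇒nonZero; prime⇒nonTrivial)
import Data.Nat.Coprimality as Cop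
import Data.Integer as ℤ
open ℤ using (ℤ; +_; -[1+_])
import Data.Integer.Properties as ℤP
open import Data.Integer.GCD using (gcd)
import Data.Integer.Divisibility as ℤD
import Data.Integer.Divisibility.Signed as ℤS
import Data.Rational as ℚ
open ℚ using (ℚ; 0ℚ; 1ℚ; _+_; _*_; _-_; -_; toℚᵘ; ↥_; ↧_)
import Data.Rational.Properties as ℚP
import Data.Rational.Unnormalised as ℚᵘ
import Data.Rational.Unnormalised.Properties as ℚᵘP
import Data.Rational.Solver as ℚSolver
import Data.Nat.Solver as ℕSolver
open import Data.List using (List; []; _∷_; filter; upTo)
open import Data.Nat.ListAction using (product)
open import Data.Nat.ListAction.Properties using (∈⇒∣product)
open import Data.List.Membership.Propositional using (_∈_; find)
open import Data.List.Membership.Propositional.Properties using (∈-filter⁺; ∈-filter⁻; ∈-upTo⁺)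
import Data.List.Relation.Unary.All as All
open All using (All; []; _∷_; all?)
open import Data.List.Relation.Unary.All.Properties using (¬All⇒Any¬)
open import Data.List.Relation.Unary.AllPairs using ([]; _∷_)
open import Data.List.Relation.Unary.Unique.Propositional using (Unique)
import Data.List.Relation.Unary.Unique.Propositional.Properties as Unique
open import Relation.Nullary.Decidable using (_×-dec_)
open import Data.Product using (∃; ∃₂; _×_; _,_; proj₁; proj₂)
open import Data.Sum using (inj₁; inj₂; [_,_]′)
open import Function.Base using (id)
open import Relation.Binary.PropositionalEquality
open import Relation.Nullary using (¬_; yes; no)
open import Data.Empty using (⊥-elim)
open import Function.Bundles using (_⇔_; mk⇔)
import Relation.Binary.Reasoning.Base.Single

module ℕR = ℕSolver.+-*-Solver
open ℚSolver.+-*-Solver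

ι≃mkℚᵘ : ∀ z → toℚᵘ (ι z) ℚᵘ.≃ ℚᵘ.mkℚᵘ z 0
ι≃mkℚᵘ z = ℚP.toℚᵘ-fromℚᵘ (ℚᵘ.mkℚᵘ z 0)

ι-+ : ∀ a b → ι (a ℤ.+ b) ≡ ι a + ι b
ι-+ a b = ℚP.toℚᵘ-injective (ℚᵘP.≃-trans (ι≃mkℚᵘ (a ℤ.+ b)) (ℚᵘP.≃-trans (ℚᵘ.*≡* eq)
   (ℚᵘP.≃-sym (ℚᵘP.≃-trans (ℚP.toℚᵘ-homo-+ (ι a) (ι b)) (ℚᵘP.+-cong (ι≃mkℚᵘ a) (ι≃mkℚᵘ b))))))
  where
  eq : (a ℤ.+ b) ℤ.* (+ 1 ℤ.* + 1) ≡ (a ℤ.* + 1 ℤ.+ b ℤ.* + 1) ℤ.* + 1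
  eq = trans (ℤP.*-identityʳ (a ℤ.+ b)) (sym (trans (ℤP.*-identityʳ _) (cong₂ ℤ._+_ (ℤP.*-identityʳ a) (ℤP.*-identityʳ b))))

ι-* : ∀ a b → ι (a ℤ.* b) ≡ ι a * ι b
ι-* a b = ℚP.toℚᵘ-injective (ℚᵘP.≃-trans (ι≃mkℚᵘ (a ℤ.* b)) (ℚᵘP.≃-trans (ℚᵘ.*≡* eq)
   (ℚᵘP.≃-sym (ℚᵘP.≃-trans (ℚP.toℚᵘ-homo-* (ι a) (ι b)) (ℚᵘP.*-cong (ι≃mkℚᵘ a) (ι≃mkℚᵘ b))))))
  where
  eq : (a ℤ.* b) ℤ.* (+ 1 ℤ.* + 1) ≡ (a ℤ.* b) ℤ.* + 1
  eq = cong ((a ℤ.* b) ℤ.*_) (ℤP.*-identityˡ (+ 1))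

ι-neg : ∀ a → ι (ℤ.- a) ≡ - ι a
ι-neg a = ℚP.toℚᵘ-injective (ℚᵘP.≃-trans (ι≃mkℚᵘ (ℤ.- a)) (ℚᵘP.≃-trans (ℚᵘ.*≡* refl)
   (ℚᵘP.≃-sym (ℚᵘP.≃-trans (ℚP.toℚᵘ-homo‿- (ι a)) (ℚᵘP.-‿cong (ι≃mkℚᵘ a))))))

ι-injective : ∀ {a b} → ι a ≡ ι b → a ≡ b
ι-injective {a} {b} eq with ℚᵘP.≃-trans (ℚᵘP.≃-sym (ι≃mkℚᵘ a)) (ℚᵘP.≃-trans (ℚP.toℚᵘ-cong eq) (ι≃mkℚᵘ b))
... | ℚᵘ.*≡* e = trans (sym (ℤP.*-identityʳ a)) (trans e (ℤP.*-identityʳ b))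

ι-^ : ∀ a n → ι (a ℤ.^ n) ≡ ι a ^ℚ n
ι-^ a zero    = refl
ι-^ a (suc n) = trans (ι-* a (a ℤ.^ n)) (cong (ι a *_) (ι-^ a n))

ι≢0 : ∀ {a} → a ≢ + 0 → ι a ≢ 0ℚ
ι≢0 a≢0 e = a≢0 (ι-injective e)

*ι↧≡ι↥ : ∀ q → q * ι (↧ q) ≡ ι (↥ q)
*ι↧≡ι↥ q@record{} = ℚP.toℚᵘ-injective (ℚᵘP.≃-trans (ℚP.toℚᵘ-homo-* q (ι (↧ q)))
   (ℚᵘP.≃-trans (ℚᵘP.*-cong (ℚᵘP.≃-refl {toℚᵘ q}) (ι≃mkℚᵘ (↧ q)))
   (ℚᵘP.≃-trans (ℚᵘ.*≡* eq) (ℚᵘP.≃-sym (ι≃mkℚᵘ (↥ q))))))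
  where
  eq : (↥ q ℤ.* ↧ q) ℤ.* + 1 ≡ ↥ q ℤ.* (↧ q ℤ.* + 1)
  eq = ℤP.*-assoc (↥ q) (↧ q) (+ 1)

inv-inverseʳ : ∀ q → q ≢ 0ℚ → q * inv q ≡ 1ℚ
inv-inverseʳ q q≢0 with q ℚP.≟ 0ℚ
... | yes q≡0 = ⊥-elim (q≢0 q≡0)
... | no q≢0' = ℚP.*-inverseʳ q {{ℚ.≢-nonZero q≢0'}}

inv-inverseˡ : ∀ q → q ≢ 0ℚ → inv q * q ≡ 1ℚ
inv-inverseˡ q q≢0 = trans (ℚP.*-comm (inv q) q) (inv-inverseʳ q q≢0)

^ℚ-distribʳ-* : ∀ p q n → (p * q) ^ℚ n ≡ p ^ℚ n * q ^ℚ n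
^ℚ-distribʳ-* p q zero    = refl
^ℚ-distribʳ-* p q (suc n) rewrite ^ℚ-distribʳ-* p q n =
  solve 4 (λ p q a b → (p :* q) :* (a :* b) := (p :* a) :* (q :* b)) refl p q (p ^ℚ n) (q ^ℚ n)

^ℚ-+ : ∀ p m n → p ^ℚ (m ℕ.+ n) ≡ p ^ℚ m * p ^ℚ n
^ℚ-+ p zero    n = sym (ℚP.*-identityˡ _)
^ℚ-+ p (suc m) n rewrite ^ℚ-+ p m n = sym (ℚP.*-assoc p _ _)

1^ℚ : ∀ n → 1ℚ ^ℚ n ≡ 1ℚ
1^ℚ zero    = refl
1^ℚ (suc n) rewrite 1^ℚ n = refl

^ℚ-inverseʳ : ∀ q n → q ≢ 0ℚ → q ^ℚ n * inv q ^ℚ n ≡ 1ℚ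
^ℚ-inverseʳ q n q≢0 = begin
  q ^ℚ n * inv q ^ℚ n ≡⟨ sym (^ℚ-distribʳ-* q (inv q) n) ⟩
  (q * inv q) ^ℚ n    ≡⟨ cong (_^ℚ n) (inv-inverseʳ q q≢0) ⟩
  1ℚ ^ℚ n             ≡⟨ 1^ℚ n ⟩
  1ℚ                  ∎
  where open ≡-Reasoning

inv^ℚ-cancelˡ : ∀ q n x → q ≢ 0ℚ → inv q ^ℚ n * (q ^ℚ n * x) ≡ x
inv^ℚ-cancelˡ q n x q≢0 = begin
  inv q ^ℚ n * (q ^ℚ n * x) ≡⟨ sym (ℚP.*-assoc (inv q ^ℚ n) _ x) ⟩
  inv q ^ℚ n * q ^ℚ n * x   ≡⟨ cong (_* x) (trans (ℚP.*-comm (inv q ^ℚ n) _) (^ℚ-inverseʳ q n q≢0)) ⟩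
  1ℚ * x                    ≡⟨ ℚP.*-identityˡ x ⟩
  x                         ∎
  where open ≡-Reasoning

^ℚ-cancelˡ : ∀ q n x → q ≢ 0ℚ → q ^ℚ n * (inv q ^ℚ n * x) ≡ x
^ℚ-cancelˡ q n x q≢0 = begin
  q ^ℚ n * (inv q ^ℚ n * x) ≡⟨ sym (ℚP.*-assoc (q ^ℚ n) _ x) ⟩
  q ^ℚ n * inv q ^ℚ n * x   ≡⟨ cong (_* x) (^ℚ-inverseʳ q n q≢0) ⟩
  1ℚ * x                    ≡⟨ ℚP.*-identityˡ x ⟩
  x                         ∎
  where open ≡-Reasoning

-- Integral rationals and the rings ℤ[1/l]

Integral : ℚ → Set
Integral q = ∃ λ a → q ≡ ι a

integral-ι : ∀ a → Integral (ι a)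
integral-ι a = a , refl

integral-+ : ∀ {p q} → Integral p → Integral q → Integral (p + q)
integral-+ (a , refl) (b , refl) = a ℤ.+ b , sym (ι-+ a b)

integral-* : ∀ {p q} → Integral p → Integral q → Integral (p * q)
integral-* (a , refl) (b , refl) = a ℤ.* b , sym (ι-* a b)

integral-neg : ∀ {p} → Integral p → Integral (- p)
integral-neg (a , refl) = ℤ.- a , sym (ι-neg a)

integral-- : ∀ {p q} → Integral p → Integral q → Integral (p - q)
integral-- ip iq = integral-+ ip (integral-neg iq)

integral-^ : ∀ {p} n → Integral p → Integral (p ^ℚ n)
integral-^ n (a , refl) = a ℤ.^ n , sym (ι-^ a n)

integral-≡ : ∀ {p q} → p ≡ q → Integral p → Integral q
integral-≡ = subst Integral

infix 4 _∈ℤ[1/_]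

-- Equivalent to Zinv l when l ≠ 0, but closure properties need no bookkeeping of numerators.
record _∈ℤ[1/_] (q : ℚ) (l : ℤ) : Set where
  constructor scaled
  field
    exponent : ℕ
    integral : Integral (ι l ^ℚ exponent * q)

module _ {l : ℤ} where

  integral⇒∈ℤ[1/] : ∀ {q} → Integral q → q ∈ℤ[1/ l ]
  integral⇒∈ℤ[1/] {q} int = scaled 0 (integral-≡ (sym (ℚP.*-identityˡ q)) int)

  ∈ℤ[1/]-*ˡ : ∀ {c q} → Integral c → q ∈ℤ[1/ l ] → c * q ∈ℤ[1/ l ]
  ∈ℤ[1/]-*ˡ {c} {q} ic (scaled n int) = scaled n (integral-≡
    (solve 3 (λ c L q → c :* (L :* q) := L :* (c :* q)) refl c (ι l ^ℚ n) q) (integral-* ic int))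

  ∈ℤ[1/]-neg : ∀ {q} → q ∈ℤ[1/ l ] → - q ∈ℤ[1/ l ]
  ∈ℤ[1/]-neg {q} (scaled n int) = scaled n (integral-≡ (ℚP.neg-distribʳ-* (ι l ^ℚ n) q) (integral-neg int))

  Zinv⇒∈ℤ[1/] : ∀ {q} → l ≢ + 0 → Zinv l q → q ∈ℤ[1/ l ]
  Zinv⇒∈ℤ[1/] l≢0 (a , n , refl) = scaled n (integral-≡
    (sym (trans (cong (ι l ^ℚ n *_) (ℚP.*-comm (ι a) _)) (^ℚ-cancelˡ (ι l) n (ι a) (ι≢0 l≢0)))) (integral-ι a))

  ∈ℤ[1/]⇒Zinv : ∀ {q} → l ≢ + 0 → q ∈ℤ[1/ l ] → Zinv l q
  ∈ℤ[1/]⇒Zinv {q} l≢0 (scaled n (a , Lⁿq≡a)) = a , n , (begin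
    q                             ≡⟨ sym (inv^ℚ-cancelˡ (ι l) n q (ι≢0 l≢0)) ⟩
    inv (ι l) ^ℚ n * (ι l ^ℚ n * q) ≡⟨ cong (inv (ι l) ^ℚ n *_) Lⁿq≡a ⟩
    inv (ι l) ^ℚ n * ι a            ≡⟨ ℚP.*-comm _ (ι a) ⟩
    ι a * inv (ι l) ^ℚ n            ∎)
    where open ≡-Reasoning

∈ℤ[1/]-⊆-* : ∀ {q l} m → q ∈ℤ[1/ l ] → q ∈ℤ[1/ l ℤ.* m ]
∈ℤ[1/]-⊆-* {q} {l} m (scaled n int) = scaled n (integral-≡ eq (integral-* (integral-^ n (integral-ι m)) int))
  where
  eq : ι m ^ℚ n * (ι l ^ℚ n * q) ≡ ι (l ℤ.* m) ^ℚ n * q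
  eq = trans (solve 3 (λ M L q → M :* (L :* q) := L :* M :* q) refl (ι m ^ℚ n) (ι l ^ℚ n) q)
             (cong (_* q) (sym (trans (cong (_^ℚ n) (ι-* l m)) (^ℚ-distribʳ-* (ι l) (ι m) n))))

-- p-adic valuations

n<m^n : ∀ {m} n → 1 < m → n < m ℕ.^ n
n<m^n zero    _   = ℕ.s≤s ℕ.z≤n
n<m^n {m} (suc n) 1<m = begin-strict
  suc n                 <⟨ ℕP.+-monoʳ-< 1 (n<m^n n 1<m) ⟩
  1 ℕ.+ m ℕ.^ n         ≤⟨ ℕP.+-monoˡ-≤ (m ℕ.^ n) (ℕP.m^n>0 m n) ⟩
  m ℕ.^ n ℕ.+ m ℕ.^ n   ≡⟨ cong (m ℕ.^ n ℕ.+_) (sym (ℕP.+-identityʳ (m ℕ.^ n))) ⟩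
  2 ℕ.* m ℕ.^ n         ≤⟨ ℕP.*-monoˡ-≤ (m ℕ.^ n) 1<m ⟩
  m ℕ.* m ℕ.^ n         ∎
  where
  open ℕP.≤-Reasoning
  instance _ = ℕ.>-nonZero (ℕP.<-trans ℕ.z<s 1<m)

module _ {p : ℕ} (p-prime : Prime p) where

  private
    1<p : 1 < p
    1<p = ℕ.nonTrivial⇒n>1 p {{prime⇒nonTrivial p-prime}}

  prime∤1 : ¬ p ∣ 1
  prime∤1 p∣1 = ℕP.<-irrefl (sym (ℕD.∣1⇒≡1 p∣1)) 1<p

  prime∤^ : ∀ {b} → ¬ p ∣ b → ∀ n → ¬ p ∣ b ℕ.^ n
  prime∤^ p∤b zero    = prime∤1
  prime∤^ p∤b (suc n) p∣ with euclidsLemma _ _ p-prime p∣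
  ... | inj₁ p∣b  = p∤b p∣b
  ... | inj₂ p∣bⁿ = prime∤^ p∤b n p∣bⁿ

  prime^∣*⇒∣ : ∀ {c} → ¬ p ∣ c → ∀ k y → p ℕ.^ k ∣ c ℕ.* y → p ℕ.^ k ∣ y
  prime^∣*⇒∣ p∤c zero    y _ = ℕD.1∣ y
  prime^∣*⇒∣ {c} p∤c (suc k) y pᵏ⁺¹∣cy with euclidsLemma c y p-prime (ℕD.∣-trans (ℕD.m∣m*n (p ℕ.^ k)) pᵏ⁺¹∣cy)
  ... | inj₁ p∣c = ⊥-elim (p∤c p∣c)
  ... | inj₂ (divides y′ refl) =
    subst (p ℕ.* p ℕ.^ k ∣_) (ℕP.*-comm p y′) (ℕD.*-monoʳ-∣ p (prime^∣*⇒∣ p∤c k y′ pᵏ∣cy′))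
    where
    cy≡ : c ℕ.* (y′ ℕ.* p) ≡ p ℕ.* (c ℕ.* y′)
    cy≡ = ℕR.solve 3 (λ c y p → c ℕR.:* (y ℕR.:* p) ℕR.:= p ℕR.:* (c ℕR.:* y)) refl c y′ p
    pᵏ∣cy′ : p ℕ.^ k ∣ c ℕ.* y′
    pᵏ∣cy′ = ℕD.*-cancelˡ-∣ p {{prime⇒nonZero p-prime}} (subst (p ℕ.* p ℕ.^ k ∣_) cy≡ pᵏ⁺¹∣cy)

  unbounded-valuation⇒≡0 : ∀ {b} X → ¬ p ∣ b → (∀ k → ∃ λ n → p ℕ.^ k ∣ b ℕ.^ n ℕ.* X) → X ≡ 0
  unbounded-valuation⇒≡0 zero    _   _   = refl
  unbounded-valuation⇒≡0 (suc X) p∤b div with div (suc X)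
  ... | n , pᵏ∣ = ⊥-elim (ℕP.<⇒≱ (n<m^n (suc X) 1<p)
                    (ℕD.∣⇒≤ (prime^∣*⇒∣ (prime∤^ p∤b n) (suc X) (suc X) pᵏ∣)))

abs-^ : ∀ a n → ℤ.∣ a ℤ.^ n ∣ ≡ ℤ.∣ a ∣ ℕ.^ n
abs-^ a zero    = refl
abs-^ a (suc n) = trans (ℤP.abs-* a (a ℤ.^ n)) (cong (ℤ.∣ a ∣ ℕ.*_) (abs-^ a n))

∣⇒^∣^ : ∀ {m n} k → m ∣ n → m ℕ.^ k ∣ n ℕ.^ k
∣⇒^∣^ zero    _   = ℕD.∣-refl
∣⇒^∣^ (suc k) m∣n = ℕD.*-pres-∣ m∣n (∣⇒^∣^ k m∣n)

ι-*^* : ∀ a b n c → ι (a ℤ.* b ℤ.^ n ℤ.* c) ≡ ι a * ι b ^ℚ n * ι c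
ι-*^* a b n c = trans (ι-* (a ℤ.* b ℤ.^ n) c) (cong (_* ι c) (trans (ι-* a (b ℤ.^ n)) (cong (ι a *_) (ι-^ b n))))

abs-*^* : ∀ a b n c → ℤ.∣ a ℤ.* b ℤ.^ n ℤ.* c ∣ ≡ ℤ.∣ a ∣ ℕ.* ℤ.∣ b ∣ ℕ.^ n ℕ.* ℤ.∣ c ∣
abs-*^* a b n c = trans (ℤP.abs-* (a ℤ.* b ℤ.^ n) c) (cong (ℕ._* ℤ.∣ c ∣) (trans (ℤP.abs-* a (b ℤ.^ n)) (cong (ℤ.∣ a ∣ ℕ.*_) (abs-^ b n))))

module _ {p : ℕ} (p-prime : Prime p) {v l l′ : ℤ}
         (p∣l : p ∣ ℤ.∣ l ∣) (p∤l′ : ¬ p ∣ ℤ.∣ l′ ∣) (v≢0 : v ≢ + 0) (l≢0 : l ≢ + 0) where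

  private
    clear-denominators : ∀ γ N D n k c → γ * ι D ≡ ι N →
      ι v * ι l′ ^ℚ n * γ * inv (ι l) ^ℚ k ≡ ι c → v ℤ.* l′ ℤ.^ n ℤ.* N ≡ c ℤ.* l ℤ.^ k ℤ.* D
    clear-denominators γ N D n k c γD≡N eq = ι-injective (begin
      ι (v ℤ.* l′ ℤ.^ n ℤ.* N)               ≡⟨ ι-*^* v l′ n N ⟩
      X * ι N                                ≡⟨ cong (X *_) (sym γD≡N) ⟩
      X * (γ * ι D)                          ≡⟨ sym (ℚP.*-assoc X γ (ι D)) ⟩
      X * γ * ι D                            ≡⟨ cong (X * γ *_) (sym (inv^ℚ-cancelˡ L k (ι D) (ι≢0 l≢0))) ⟩
      X * γ * (inv L ^ℚ k * (L ^ℚ k * ι D))  ≡⟨ sym (ℚP.*-assoc (X * γ) (inv L ^ℚ k) _) ⟩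
      X * γ * inv L ^ℚ k * (L ^ℚ k * ι D)    ≡⟨ cong (_* (L ^ℚ k * ι D)) eq ⟩
      ι c * (L ^ℚ k * ι D)                   ≡⟨ sym (ℚP.*-assoc (ι c) (L ^ℚ k) (ι D)) ⟩
      ι c * L ^ℚ k * ι D                     ≡⟨ sym (ι-*^* c l k D) ⟩
      ι (c ℤ.* l ℤ.^ k ℤ.* D)                ∎)
      where
      open ≡-Reasoning
      L X : ℚ
      L = ι l
      X = ι v * ι l′ ^ℚ n

    p^k-divides : ∀ N D n k c → v ℤ.* l′ ℤ.^ n ℤ.* N ≡ c ℤ.* l ℤ.^ k ℤ.* D →
      p ℕ.^ k ∣ ℤ.∣ l′ ∣ ℕ.^ n ℕ.* (ℤ.∣ v ∣ ℕ.* ℤ.∣ N ∣)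
    p^k-divides N D n k c eq = subst (p ℕ.^ k ∣_) rearrange (ℕD.∣-trans (∣⇒^∣^ k p∣l) lᵏ∣)
      where
      lᵏ∣ : ℤ.∣ l ∣ ℕ.^ k ∣ ℤ.∣ v ℤ.* l′ ℤ.^ n ℤ.* N ∣
      lᵏ∣ = subst (ℤ.∣ l ∣ ℕ.^ k ∣_) (sym (trans (cong ℤ.∣_∣ eq) (abs-*^* c l k D)))
              (ℕD.∣m⇒∣m*n ℤ.∣ D ∣ (ℕD.∣n⇒∣m*n ℤ.∣ c ∣ ℕD.∣-refl))
      rearrange : ℤ.∣ v ℤ.* l′ ℤ.^ n ℤ.* N ∣ ≡ ℤ.∣ l′ ∣ ℕ.^ n ℕ.* (ℤ.∣ v ∣ ℕ.* ℤ.∣ N ∣)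
      rearrange = trans (abs-*^* v l′ n N)
        (ℕR.solve 3 (λ a b c → a ℕR.:* b ℕR.:* c ℕR.:= b ℕR.:* (a ℕR.:* c)) refl ℤ.∣ v ∣ (ℤ.∣ l′ ∣ ℕ.^ n) ℤ.∣ N ∣)

  -- Writing γ = N/D, the hypothesis says pᵏ divides l′ⁿ·v·N for every k.
  ≡0-if-divisible-by-all-powers : ∀ γ → (∀ k → ∃ λ n → Integral (ι v * ι l′ ^ℚ n * γ * inv (ι l) ^ℚ k)) → γ ≡ 0ℚ
  ≡0-if-divisible-by-all-powers γ div = ℚP.↥p≡0⇒p≡0 γ (ℤP.∣i∣≡0⇒i≡0 ∣N∣≡0)
    where
    N : ℤ
    N = ↥ γ
    vN≡0 : ℤ.∣ v ∣ ℕ.* ℤ.∣ N ∣ ≡ 0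
    vN≡0 = unbounded-valuation⇒≡0 p-prime _ p∤l′ λ k →
      let (n , c , eq) = div k in
      n , p^k-divides N (↧ γ) n k c (clear-denominators γ N (↧ γ) n k c (*ι↧≡ι↥ γ) eq)
    ∣N∣≡0 : ℤ.∣ N ∣ ≡ 0
    ∣N∣≡0 = [ (λ ∣v∣≡0 → ⊥-elim (v≢0 (ℤP.∣i∣≡0⇒i≡0 ∣v∣≡0))) , id ]′ (ℕP.m*n≡0⇒m≡0∨n≡0 ℤ.∣ v ∣ vN≡0)

-- Radicals

primeDivisors : ℤ → List ℕ
primeDivisors m = filter (λ p → prime? p ×-dec (p ∣? ℤ.∣ m ∣)) (upTo (suc ℤ.∣ m ∣))

prime∤product : ∀ {p} → Prime p → ∀ qs → All Prime qs → All (p ≢_) qs → ¬ p ∣ product qs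
prime∤product pp []       []         []          p∣1 = prime∤1 pp p∣1
prime∤product pp (q ∷ qs) (pq ∷ pqs) (p≢q ∷ p≢qs) p∣ with euclidsLemma q (product qs) pp p∣
... | inj₂ p∣qs = prime∤product pp qs pqs p≢qs p∣qs
... | inj₁ p∣q with prime⇒irreducible pq p∣q
...   | inj₁ refl = prime∤1 pp ℕD.∣-refl
...   | inj₂ p≡q  = p≢q p≡q

prime∤⇒coprime : ∀ {p n} → Prime p → ¬ p ∣ n → Cop.Coprime p n
prime∤⇒coprime pp p∤n (d∣p , d∣n) with prime⇒irreducible pp d∣p
... | inj₁ d≡1 = d≡1
... | inj₂ refl = ⊥-elim (p∤n d∣n)

product-of-distinct-primes-∣ : ∀ qs {n} → Unique qs → All Prime qs → All (_∣ n) qs → product qs ∣ n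
product-of-distinct-primes-∣ []       _          _          _                      = ℕD.1∣ _
product-of-distinct-primes-∣ (q ∷ qs) (q∉ ∷ uqs) (pq ∷ pqs) (divides k refl ∷ qs∣) =
  subst (q ℕ.* product qs ∣_) (ℕP.*-comm q k) (ℕD.*-monoʳ-∣ q qs∣k)
  where
  qs∣k : product qs ∣ k
  qs∣k = Cop.coprime-divisor (Cop.sym (prime∤⇒coprime pq (prime∤product pq qs pqs q∉)))
           (subst (product qs ∣_) (ℕP.*-comm k q) (product-of-distinct-primes-∣ qs uqs pqs qs∣))

∈primeDivisors⁻ : ∀ m {p} → p ∈ primeDivisors m → Prime p × p ∣ ℤ.∣ m ∣
∈primeDivisors⁻ m p∈ = proj₂ (∈-filter⁻ (λ p → prime? p ×-dec (p ∣? ℤ.∣ m ∣)) {xs = upTo (suc ℤ.∣ m ∣)} p∈)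

∈primeDivisors⁺ : ∀ m {p} → m ≢ + 0 → Prime p → p ∣ ℤ.∣ m ∣ → p ∈ primeDivisors m
∈primeDivisors⁺ m m≢0 pp p∣m = ∈-filter⁺ (λ p → prime? p ×-dec (p ∣? ℤ.∣ m ∣)) {xs = upTo (suc ℤ.∣ m ∣)}
  (∈-upTo⁺ (ℕ.s≤s (ℕD.∣⇒≤ {{ℕ.≢-nonZero (λ e → m≢0 (ℤP.∣i∣≡0⇒i≡0 e))}} p∣m))) (pp , p∣m)

rad∤rad⇒prime : ∀ l₁ l₂ → l₂ ≢ + 0 → ¬ (rad l₁ ∣ rad l₂) → ∃ λ p → Prime p × p ∣ ℤ.∣ l₁ ∣ × ¬ p ∣ ℤ.∣ l₂ ∣
rad∤rad⇒prime l₁ l₂ l₂≢0 rad∤ with all? (_∣? ℤ.∣ l₂ ∣) (primeDivisors l₁)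
... | no ¬all∣ with find (¬All⇒Any¬ (_∣? ℤ.∣ l₂ ∣) (primeDivisors l₁) ¬all∣)
...   | p , p∈ , p∤l₂ = p , proj₁ (∈primeDivisors⁻ l₁ p∈) , proj₂ (∈primeDivisors⁻ l₁ p∈) , p∤l₂
rad∤rad⇒prime l₁ l₂ l₂≢0 rad∤ | yes all∣ =
  ⊥-elim (rad∤ (product-of-distinct-primes-∣ (primeDivisors l₁) unique primes (All.tabulate ∣rad₂)))
  where
  unique : Unique (primeDivisors l₁)
  unique = Unique.filter⁺ (λ p → prime? p ×-dec (p ∣? ℤ.∣ l₁ ∣)) (Unique.upTo⁺ (suc ℤ.∣ l₁ ∣))
  primes : All Prime (primeDivisors l₁)
  primes = All.tabulate (λ p∈ → proj₁ (∈primeDivisors⁻ l₁ p∈))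
  ∣rad₂ : ∀ {p} → p ∈ primeDivisors l₁ → p ∣ rad l₂
  ∣rad₂ p∈ = ∈⇒∣product (∈primeDivisors⁺ l₂ l₂≢0 (proj₁ (∈primeDivisors⁻ l₁ p∈)) (All.lookup all∣ p∈))

-- 2×2 matrices acting on ℚ²

mat-≡ : ∀ {a b c d a′ b′ c′ d′ : ℚ} → a ≡ a′ → b ≡ b′ → c ≡ c′ → d ≡ d′ → mat a b c d ≡ mat a′ b′ c′ d′
mat-≡ refl refl refl refl = refl

·-▹ : ∀ P Q w → (P · Q) ▹ w ≡ P ▹ (Q ▹ w)
·-▹ (mat a b c d) (mat a′ b′ c′ d′) (x , y) = cong₂ _,_
  (solve 10 (λ a b c d a′ b′ c′ d′ x y → (a :* a′ :+ b :* c′) :* x :+ (a :* b′ :+ b :* d′) :* y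
      := a :* (a′ :* x :+ b′ :* y) :+ b :* (c′ :* x :+ d′ :* y)) refl a b c d a′ b′ c′ d′ x y)
  (solve 10 (λ a b c d a′ b′ c′ d′ x y → (c :* a′ :+ d :* c′) :* x :+ (c :* b′ :+ d :* d′) :* y
      := c :* (a′ :* x :+ b′ :* y) :+ d :* (c′ :* x :+ d′ :* y)) refl a b c d a′ b′ c′ d′ x y)

I₂-▹ : ∀ w → I₂ ▹ w ≡ w
I₂-▹ (x , y) = cong₂ _,_ (solve 2 (λ x y → con 1ℚ :* x :+ con 0ℚ :* y := x) refl x y)
                   (solve 2 (λ x y → con 0ℚ :* x :+ con 1ℚ :* y := y) refl x y)

▹-ext : ∀ P Q → (∀ w → P ▹ w ≡ Q ▹ w) → P ≡ Q
▹-ext (mat a b c d) (mat a′ b′ c′ d′) P▹≡Q▹ =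
  mat-≡ (trans (sym (e₁ a b)) (trans (cong proj₁ (P▹≡Q▹ (1ℚ , 0ℚ))) (e₁ a′ b′)))
        (trans (sym (e₂ a b)) (trans (cong proj₁ (P▹≡Q▹ (0ℚ , 1ℚ))) (e₂ a′ b′)))
        (trans (sym (e₁ c d)) (trans (cong proj₂ (P▹≡Q▹ (1ℚ , 0ℚ))) (e₁ c′ d′)))
        (trans (sym (e₂ c d)) (trans (cong proj₂ (P▹≡Q▹ (0ℚ , 1ℚ))) (e₂ c′ d′)))
  where
  e₁ : ∀ a b → a * 1ℚ + b * 0ℚ ≡ a
  e₁ = solve 2 (λ a b → a :* con 1ℚ :+ b :* con 0ℚ := a) refl
  e₂ : ∀ a b → a * 0ℚ + b * 1ℚ ≡ b
  e₂ = solve 2 (λ a b → a :* con 0ℚ :+ b :* con 1ℚ := b) refl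

inverse-▹-cancelˡ : ∀ P → det P ≢ 0ℚ → ∀ w → inverse P ▹ (P ▹ w) ≡ w
inverse-▹-cancelˡ P@(mat a b c d) det≢0 (x , y) = cong₂ _,_
  (trans (solve 7 (λ δ a b c d x y → δ :* d :* (a :* x :+ b :* y) :+ δ :* (:- b) :* (c :* x :+ d :* y)
                  := (δ :* (a :* d :- b :* c)) :* x) refl (inv (det P)) a b c d x y)
         (trans (cong (_* x) (inv-inverseˡ (det P) det≢0)) (ℚP.*-identityˡ x)))
  (trans (solve 7 (λ δ a b c d x y → δ :* (:- c) :* (a :* x :+ b :* y) :+ δ :* a :* (c :* x :+ d :* y)
                  := (δ :* (a :* d :- b :* c)) :* y) refl (inv (det P)) a b c d x y)
         (trans (cong (_* y) (inv-inverseˡ (det P) det≢0)) (ℚP.*-identityˡ y)))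

inverse-▹-cancelʳ : ∀ P → det P ≢ 0ℚ → ∀ w → P ▹ (inverse P ▹ w) ≡ w
inverse-▹-cancelʳ P@(mat a b c d) det≢0 (x , y) = cong₂ _,_
  (trans (solve 7 (λ δ a b c d x y → a :* (δ :* d :* x :+ δ :* (:- b) :* y) :+ b :* (δ :* (:- c) :* x :+ δ :* a :* y)
                  := (δ :* (a :* d :- b :* c)) :* x) refl (inv (det P)) a b c d x y)
         (trans (cong (_* x) (inv-inverseˡ (det P) det≢0)) (ℚP.*-identityˡ x)))
  (trans (solve 7 (λ δ a b c d x y → c :* (δ :* d :* x :+ δ :* (:- b) :* y) :+ d :* (δ :* (:- c) :* x :+ δ :* a :* y)
                  := (δ :* (a :* d :- b :* c)) :* y) refl (inv (det P)) a b c d x y)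
         (trans (cong (_* y) (inv-inverseˡ (det P) det≢0)) (ℚP.*-identityˡ y)))

det-inverse : ∀ P → det P ≢ 0ℚ → det (inverse P) * det P ≡ 1ℚ
det-inverse P@(mat a b c d) det≢0 = trans
  (solve 5 (λ δ a b c d → (δ :* d :* (δ :* a) :- δ :* (:- b) :* (δ :* (:- c))) :* (a :* d :- b :* c)
     := (δ :* (a :* d :- b :* c)) :* (δ :* (a :* d :- b :* c))) refl (inv (det P)) a b c d)
  (cong₂ _*_ (inv-inverseˡ (det P) det≢0) (inv-inverseˡ (det P) det≢0))

det-· : ∀ P Q → det (P · Q) ≡ det P * det Q
det-· (mat a b c d) (mat a′ b′ c′ d′) =
  solve 8 (λ a b c d a′ b′ c′ d′ → (a :* a′ :+ b :* c′) :* (c :* b′ :+ d :* d′) :- (a :* b′ :+ b :* d′) :* (c :* a′ :+ d :* c′)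
     := (a :* d :- b :* c) :* (a′ :* d′ :- b′ :* c′)) refl a b c d a′ b′ c′ d′

det-mapι : ∀ B → det (mapM ι B) ≡ ι (detℤ B)
det-mapι (mat a b c d) = sym (trans (ι-+ (a ℤ.* d) (ℤ.- (b ℤ.* c)))
  (cong₂ _+_ (ι-* a d) (trans (ι-neg (b ℤ.* c)) (cong -_ (ι-* b c)))))

^M-suc-▹ : ∀ P n w → P ^M suc n ▹ w ≡ P ^M n ▹ (P ▹ w)
^M-suc-▹ P zero    w = trans (·-▹ P I₂ w) (trans (cong (P ▹_) (I₂-▹ w)) (sym (I₂-▹ (P ▹ w))))
^M-suc-▹ P (suc n) w = trans (·-▹ P (P ^M suc n) w)
  (trans (cong (P ▹_) (^M-suc-▹ P n w)) (sym (·-▹ P (P ^M n) (P ▹ w))))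

module _ (P : M2 ℚ) (det≢0 : det P ≢ 0ℚ) where

  ^M-inverse-▹-cancelʳ : ∀ n w → P ^M n ▹ (inverse P ^M n ▹ w) ≡ w
  ^M-inverse-▹-cancelʳ zero    w = trans (I₂-▹ _) (I₂-▹ w)
  ^M-inverse-▹-cancelʳ (suc n) w = begin
    P ^M suc n ▹ (inverse P ^M suc n ▹ w)            ≡⟨ ^M-suc-▹ P n _ ⟩
    P ^M n ▹ (P ▹ ((inverse P · inverse P ^M n) ▹ w)) ≡⟨ cong (λ t → P ^M n ▹ (P ▹ t)) (·-▹ (inverse P) _ w) ⟩
    P ^M n ▹ (P ▹ (inverse P ▹ (inverse P ^M n ▹ w))) ≡⟨ cong (P ^M n ▹_) (inverse-▹-cancelʳ P det≢0 _) ⟩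
    P ^M n ▹ (inverse P ^M n ▹ w)                    ≡⟨ ^M-inverse-▹-cancelʳ n w ⟩
    w                                                ∎
    where open ≡-Reasoning

  ^M-inverse-▹-cancelˡ : ∀ n w → inverse P ^M n ▹ (P ^M n ▹ w) ≡ w
  ^M-inverse-▹-cancelˡ zero    w = trans (I₂-▹ _) (I₂-▹ w)
  ^M-inverse-▹-cancelˡ (suc n) w = begin
    inverse P ^M suc n ▹ (P ^M suc n ▹ w)            ≡⟨ ^M-suc-▹ (inverse P) n _ ⟩
    inverse P ^M n ▹ (inverse P ▹ ((P · P ^M n) ▹ w)) ≡⟨ cong (λ t → inverse P ^M n ▹ (inverse P ▹ t)) (·-▹ P _ w) ⟩
    inverse P ^M n ▹ (inverse P ▹ (P ▹ (P ^M n ▹ w))) ≡⟨ cong (inverse P ^M n ▹_) (inverse-▹-cancelˡ P det≢0 _) ⟩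
    inverse P ^M n ▹ (P ^M n ▹ w)                    ≡⟨ ^M-inverse-▹-cancelˡ n w ⟩
    w                                                ∎
    where open ≡-Reasoning

Integral² : V2 → Set
Integral² (x , y) = Integral x × Integral y

IntegralM : M2 ℚ → Set
IntegralM (mat a b c d) = Integral a × Integral b × Integral c × Integral d

integralM-▹ : ∀ B w → IntegralM B → Integral² w → Integral² (B ▹ w)
integralM-▹ (mat a b c d) (x , y) (ia , ib , ic , id′) (ix , iy) =
  integral-+ (integral-* ia ix) (integral-* ib iy) , integral-+ (integral-* ic ix) (integral-* id′ iy)

integralM-mapι : ∀ B → IntegralM (mapM ι B)
integralM-mapι (mat a b c d) = integral-ι a , integral-ι b , integral-ι c , integral-ι d

-- Congruences of rationals modulo an integer

infix 4 _≡_[mod_]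

record _≡_[mod_] (p q : ℚ) (v : ℤ) : Set where
  constructor ≡[mod]
  field
    quotient-integral : Integral ((p - q) * inv (ι v))

module _ {v : ℤ} where

  private
    W : ℚ
    W = inv (ι v)

  ≡⇒≡[mod] : ∀ {p q} → p ≡ q → p ≡ q [mod v ]
  ≡⇒≡[mod] {p} refl = ≡[mod] (integral-≡ (sym (trans (cong (_* W) (ℚP.+-inverseʳ p)) (ℚP.*-zeroˡ W))) (integral-ι (+ 0)))

  ≡[mod]-sym : ∀ {p q} → p ≡ q [mod v ] → q ≡ p [mod v ]
  ≡[mod]-sym {p} {q} (≡[mod] i) = ≡[mod] (integral-≡
    (solve 3 (λ p q w → :- ((p :- q) :* w) := (q :- p) :* w) refl p q W) (integral-neg i))

  ≡[mod]-trans : ∀ {p q r} → p ≡ q [mod v ] → q ≡ r [mod v ] → p ≡ r [mod v ]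
  ≡[mod]-trans {p} {q} {r} (≡[mod] i) (≡[mod] j) = ≡[mod] (integral-≡
    (solve 4 (λ p q r w → (p :- q) :* w :+ (q :- r) :* w := (p :- r) :* w) refl p q r W) (integral-+ i j))

  ≡[mod]-*ˡ : ∀ {c p q} → Integral c → p ≡ q [mod v ] → c * p ≡ c * q [mod v ]
  ≡[mod]-*ˡ {c} {p} {q} ic (≡[mod] i) = ≡[mod] (integral-≡
    (solve 4 (λ c p q w → c :* ((p :- q) :* w) := (c :* p :- c :* q) :* w) refl c p q W) (integral-* ic i))

  ≡[mod]-*ʳ : ∀ {c p q} → Integral c → p ≡ q [mod v ] → p * c ≡ q * c [mod v ]
  ≡[mod]-*ʳ {c} {p} {q} ic p≡q = subst₂ (_≡_[mod v ]) (ℚP.*-comm c p) (ℚP.*-comm c q) (≡[mod]-*ˡ ic p≡q)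

  ≡[mod]-* : ∀ {p q p′ q′} → Integral q → Integral p′ → p ≡ q [mod v ] → p′ ≡ q′ [mod v ] → p * p′ ≡ q * q′ [mod v ]
  ≡[mod]-* iq ip′ p≡q p′≡q′ = ≡[mod]-trans (≡[mod]-*ʳ ip′ p≡q) (≡[mod]-*ˡ iq p′≡q′)

  ≡[mod]-^ : ∀ {p q} n → Integral p → Integral q → p ≡ q [mod v ] → p ^ℚ n ≡ q ^ℚ n [mod v ]
  ≡[mod]-^ zero    _  _  _   = ≡⇒≡[mod] refl
  ≡[mod]-^ (suc n) ip iq p≡q = ≡[mod]-* iq (integral-^ n ip) p≡q (≡[mod]-^ n ip iq p≡q)

  module ≡[mod]-Reasoning = Relation.Binary.Reasoning.Base.Single (_≡_[mod v ]) (≡⇒≡[mod] refl) ≡[mod]-trans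

  ∣⇒integral-quotient : ∀ {a} → v ≢ + 0 → v ℤS.∣ a → Integral (ι a * W)
  ∣⇒integral-quotient v≢0 (ℤS.divides c refl) = integral-≡ (sym eq) (integral-ι c)
    where
    open ≡-Reasoning
    eq : ι (c ℤ.* v) * W ≡ ι c
    eq = begin
      ι (c ℤ.* v) * W    ≡⟨ cong (_* W) (ι-* c v) ⟩
      ι c * ι v * W      ≡⟨ ℚP.*-assoc (ι c) (ι v) W ⟩
      ι c * (ι v * W)    ≡⟨ cong (ι c *_) (inv-inverseʳ (ι v) (ι≢0 v≢0)) ⟩
      ι c * 1ℚ           ≡⟨ ℚP.*-identityʳ (ι c) ⟩
      ι c                ∎

  ∣⇒ι≡ι[mod] : ∀ {a b} → v ≢ + 0 → v ℤD.∣ (a ℤ.- b) → ι a ≡ ι b [mod v ]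
  ∣⇒ι≡ι[mod] {a} {b} v≢0 v∣a-b = ≡[mod] (integral-≡ (cong (_* W) ι[a-b]≡) (∣⇒integral-quotient {a ℤ.- b} v≢0 (ℤS.∣ᵤ⇒∣ v∣a-b)))
    where
    ι[a-b]≡ : ι (a ℤ.- b) ≡ ι a - ι b
    ι[a-b]≡ = trans (ι-+ a (ℤ.- b)) (cong (λ t → ι a + t) (ι-neg b))

  coprime-cancel : ∀ {u p q} → gcd u v ≡ + 1 → v ≢ + 0 → Integral p → Integral q →
                   Integral (ι u * ((p - q) * W)) → p ≡ q [mod v ]
  coprime-cancel {u} {p} {q} gcd≡1 v≢0 ip iq (w , u[p-q]W≡w) with integral-- ip iq
  ... | a , p-q≡a = ≡[mod] (integral-≡ (cong (_* W) (sym p-q≡a)) (∣⇒integral-quotient {a} v≢0 (ℤS.∣ᵤ⇒∣ v∣a)))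
    where
    open ≡-Reasoning
    ua≡wv : u ℤ.* a ≡ w ℤ.* v
    ua≡wv = ι-injective (begin
      ι (u ℤ.* a)                 ≡⟨ ι-* u a ⟩
      ι u * ι a                   ≡⟨ cong (ι u *_) (sym (trans a*W*V≡a p-q≡a)) ⟩
      ι u * ((p - q) * W * ι v)   ≡⟨ sym (ℚP.*-assoc (ι u) _ (ι v)) ⟩
      ι u * ((p - q) * W) * ι v   ≡⟨ cong (_* ι v) u[p-q]W≡w ⟩
      ι w * ι v                   ≡⟨ sym (ι-* w v) ⟩
      ι (w ℤ.* v)                 ∎)
      where
      a*W*V≡a : (p - q) * W * ι v ≡ p - q
      a*W*V≡a = trans (ℚP.*-assoc (p - q) W (ι v)) (trans (cong ((p - q) *_) (inv-inverseˡ (ι v) (ι≢0 v≢0))) (ℚP.*-identityʳ (p - q)))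
    v∣a : v ℤD.∣ a
    v∣a = Cop.coprime-divisor (Cop.sym (Cop.gcd≡1⇒coprime {ℤ.∣ u ∣} {ℤ.∣ v ∣} (ℤP.+-injective gcd≡1)))
            (subst (ℤ.∣ v ∣ ∣_) (ℤP.abs-* u a) (ℤS.∣⇒∣ᵤ {v} {u ℤ.* a} (ℤS.divides w ua≡wv)))

-- G_A in the eigenbasis of A

module Eigenbasis (l₁ l₂ u v : ℤ) (A : M2 ℤ)
  (v≢0 : v ≢ + 0)
  (A≡MΛM⁻¹ : mapM ι A ≡ Mmat u v · diag (ι l₁) (ι l₂) · inverse (Mmat u v))
  (detA≢0 : detℤ A ≢ + 0) where

  L₁ L₂ U V : ℚ
  L₁ = ι l₁
  L₂ = ι l₂
  U = ι u
  V = ι v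

  M M⁻¹ Λ A′ : M2 ℚ
  M = Mmat u v
  M⁻¹ = inverse M
  Λ = diag L₁ L₂
  A′ = mapM ι A

  detM≡V : det M ≡ V
  detM≡V = solve 2 (λ U V → con 1ℚ :* V :- U :* con 0ℚ := V) refl U V

  detM≢0 : det M ≢ 0ℚ
  detM≢0 e = ι≢0 v≢0 (trans (sym detM≡V) e)

  detA≡l₁l₂ : detℤ A ≡ l₁ ℤ.* l₂
  detA≡l₁l₂ = ι-injective (begin
    ι (detℤ A)                     ≡⟨ sym (det-mapι A) ⟩
    det A′                         ≡⟨ cong det A≡MΛM⁻¹ ⟩
    det (M · Λ · M⁻¹)              ≡⟨ trans (det-· (M · Λ) M⁻¹) (cong (_* det M⁻¹) (det-· M Λ)) ⟩
    det M * det Λ * det M⁻¹        ≡⟨ solve 3 (λ a b c → a :* b :* c := c :* a :* b) refl (det M) (det Λ) (det M⁻¹) ⟩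
    det M⁻¹ * det M * det Λ        ≡⟨ cong (_* det Λ) (det-inverse M detM≢0) ⟩
    1ℚ * det Λ                     ≡⟨ solve 2 (λ x y → con 1ℚ :* (x :* y :- con 0ℚ :* con 0ℚ) := x :* y) refl L₁ L₂ ⟩
    L₁ * L₂                        ≡⟨ sym (ι-* l₁ l₂) ⟩
    ι (l₁ ℤ.* l₂)                  ∎)
    where open ≡-Reasoning

  l₁l₂≢0 : l₁ ℤ.* l₂ ≢ + 0
  l₁l₂≢0 e = detA≢0 (trans detA≡l₁l₂ e)

  l₁≢0 : l₁ ≢ + 0
  l₁≢0 refl = l₁l₂≢0 refl

  l₂≢0 : l₂ ≢ + 0
  l₂≢0 refl = l₁l₂≢0 (ℤP.*-zeroʳ l₁)

  Λ^ : ℕ → V2 → V2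
  Λ^ n (z₁ , z₂) = (L₁ ^ℚ n * z₁ , L₂ ^ℚ n * z₂)

  Λ^0 : ∀ z → Λ^ 0 z ≡ z
  Λ^0 (z₁ , z₂) = cong₂ _,_ (ℚP.*-identityˡ z₁) (ℚP.*-identityˡ z₂)

  Λ▹Λ^ : ∀ n z → Λ ▹ Λ^ n z ≡ Λ^ (suc n) z
  Λ▹Λ^ n (z₁ , z₂) = cong₂ _,_
    (solve 4 (λ L p z w → L :* (p :* z) :+ con 0ℚ :* w := L :* p :* z) refl L₁ (L₁ ^ℚ n) z₁ (L₂ ^ℚ n * z₂))
    (solve 4 (λ L p z w → con 0ℚ :* w :+ L :* (p :* z) := L :* p :* z) refl L₂ (L₂ ^ℚ n) z₂ (L₁ ^ℚ n * z₁))

  A′▹M▹ : ∀ n z → A′ ▹ (M ▹ Λ^ n z) ≡ M ▹ Λ^ (suc n) z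
  A′▹M▹ n z = begin
    A′ ▹ (M ▹ Λ^ n z)                 ≡⟨ cong (_▹ (M ▹ Λ^ n z)) A≡MΛM⁻¹ ⟩
    (M · Λ · M⁻¹) ▹ (M ▹ Λ^ n z)      ≡⟨ trans (·-▹ (M · Λ) M⁻¹ _) (·-▹ M Λ _) ⟩
    M ▹ (Λ ▹ (M⁻¹ ▹ (M ▹ Λ^ n z)))    ≡⟨ cong (λ t → M ▹ (Λ ▹ t)) (inverse-▹-cancelˡ M detM≢0 (Λ^ n z)) ⟩
    M ▹ (Λ ▹ Λ^ n z)                  ≡⟨ cong (M ▹_) (Λ▹Λ^ n z) ⟩
    M ▹ Λ^ (suc n) z                  ∎
    where open ≡-Reasoning

  A′^n▹M▹ : ∀ n z → A′ ^M n ▹ (M ▹ z) ≡ M ▹ Λ^ n z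
  A′^n▹M▹ zero    z = trans (I₂-▹ (M ▹ z)) (cong (M ▹_) (sym (Λ^0 z)))
  A′^n▹M▹ (suc n) z = trans (·-▹ A′ (A′ ^M n) _) (trans (cong (A′ ▹_) (A′^n▹M▹ n z)) (A′▹M▹ n z))

  -- M⁻¹ G_A, because Aⁿ M = M Λⁿ.
  InGᴹ : V2 → Set
  InGᴹ z = ∃ λ n → Integral² (M ▹ Λ^ n z)

  InGᴹ-mono : ∀ z n j → Integral² (M ▹ Λ^ n z) → Integral² (M ▹ Λ^ (j ℕ.+ n) z)
  InGᴹ-mono z n zero    int = int
  InGᴹ-mono z n (suc j) int = subst Integral² (A′▹M▹ (j ℕ.+ n) z)
    (integralM-▹ A′ _ (integralM-mapι A) (InGᴹ-mono z n j int))

  private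
    detA′≢0 : det A′ ≢ 0ℚ
    detA′≢0 e = detA≢0 (ι-injective (trans (sym (det-mapι A)) e))

    M▹M⁻¹▹ : ∀ y → M ▹ (M⁻¹ ▹ y) ≡ y
    M▹M⁻¹▹ = inverse-▹-cancelʳ M detM≢0

    ι² : ℤ × ℤ → V2
    ι² (a , b) = (ι a , ι b)

    A′^n▹y : ∀ n y → A′ ^M n ▹ y ≡ M ▹ Λ^ n (M⁻¹ ▹ y)
    A′^n▹y n y = trans (cong (A′ ^M n ▹_) (sym (M▹M⁻¹▹ y))) (A′^n▹M▹ n (M⁻¹ ▹ y))

    integral-A′^n▹ : ∀ n w → Integral² w → Integral² (A′ ^M n ▹ w)
    integral-A′^n▹ zero    w int = subst Integral² (sym (I₂-▹ w)) int
    integral-A′^n▹ (suc n) w int = subst Integral² (sym (·-▹ A′ (A′ ^M n) w))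
      (integralM-▹ A′ _ (integralM-mapι A) (integral-A′^n▹ n w int))

  InG⇒InGᴹ : ∀ y → InG A y → InGᴹ (M⁻¹ ▹ y)
  InG⇒InGᴹ y (+ n , x , refl) = 0 , subst Integral² (sym (trans (cong (M ▹_) (Λ^0 (M⁻¹ ▹ y))) (M▹M⁻¹▹ y)))
    (integral-A′^n▹ n (ι² x) (integral-ι (proj₁ x) , integral-ι (proj₂ x)))
  InG⇒InGᴹ y (-[1+ n ] , x , refl) = suc n , subst Integral²
    (trans (sym (^M-inverse-▹-cancelʳ A′ detA′≢0 (suc n) (ι² x))) (A′^n▹y (suc n) y))
    (integral-ι (proj₁ x) , integral-ι (proj₂ x))

  InGᴹ⇒InG : ∀ y → InGᴹ (M⁻¹ ▹ y) → InG A y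
  InGᴹ⇒InG y (n , int) = from-power n (subst Integral² (sym (A′^n▹y n y)) int)
    where
    from-power : ∀ n → Integral² (A′ ^M n ▹ y) → InG A y
    from-power zero    ((a , I▹y≡a) , (b , I▹y≡b)) =
      + 0 , (a , b) , trans (sym (I₂-▹ y)) (trans (cong₂ _,_ I▹y≡a I▹y≡b) (sym (I₂-▹ (ι² (a , b)))))
    from-power (suc m) ((a , A′ⁿ▹y≡a) , (b , A′ⁿ▹y≡b)) =
      -[1+ m ] , (a , b) , trans (sym (^M-inverse-▹-cancelˡ A′ detA′≢0 (suc m) y)) (cong (inverse A′ ^M suc m ▹_) (cong₂ _,_ A′ⁿ▹y≡a A′ⁿ▹y≡b))

  Preserves : M2 ℚ → Set
  Preserves X = ∀ z → InGᴹ z → InGᴹ (X ▹ z)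

  IsEnd⇒Preserves : ∀ T → IsEnd A T → Preserves (M⁻¹ · T · M)
  IsEnd⇒Preserves T T-end z z∈ = subst InGᴹ (sym M⁻¹TM▹z)
    (InG⇒InGᴹ (T ▹ (M ▹ z)) (T-end (M ▹ z) (InGᴹ⇒InG (M ▹ z) (subst InGᴹ (sym (inverse-▹-cancelˡ M detM≢0 z)) z∈))))
    where
    M⁻¹TM▹z : (M⁻¹ · T · M) ▹ z ≡ M⁻¹ ▹ (T ▹ (M ▹ z))
    M⁻¹TM▹z = trans (·-▹ (M⁻¹ · T) M z) (·-▹ M⁻¹ T (M ▹ z))

  MXM⁻¹-▹ : ∀ X y → (M · X · M⁻¹) ▹ y ≡ M ▹ (X ▹ (M⁻¹ ▹ y))
  MXM⁻¹-▹ X y = trans (·-▹ (M · X) M⁻¹ y) (·-▹ M X (M⁻¹ ▹ y))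

  Preserves⇒IsEnd : ∀ X → Preserves X → IsEnd A (M · X · M⁻¹)
  Preserves⇒IsEnd X X-pres y y∈ = InGᴹ⇒InG _ (subst InGᴹ M⁻¹▹MXM⁻¹y (X-pres (M⁻¹ ▹ y) (InG⇒InGᴹ y y∈)))
    where
    M⁻¹▹MXM⁻¹y : X ▹ (M⁻¹ ▹ y) ≡ M⁻¹ ▹ ((M · X · M⁻¹) ▹ y)
    M⁻¹▹MXM⁻¹y = sym (trans (cong (M⁻¹ ▹_) (MXM⁻¹-▹ X y)) (inverse-▹-cancelˡ M detM≢0 _))

  ≡MM⁻¹TMM⁻¹ : ∀ T → T ≡ M · (M⁻¹ · T · M) · M⁻¹
  ≡MM⁻¹TMM⁻¹ T = ▹-ext T _ λ w → sym (begin
    (M · (M⁻¹ · T · M) · M⁻¹) ▹ w      ≡⟨ MXM⁻¹-▹ (M⁻¹ · T · M) w ⟩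
    M ▹ ((M⁻¹ · T · M) ▹ (M⁻¹ ▹ w))    ≡⟨ cong (M ▹_) (trans (·-▹ (M⁻¹ · T) M _) (·-▹ M⁻¹ T _)) ⟩
    M ▹ (M⁻¹ ▹ (T ▹ (M ▹ (M⁻¹ ▹ w))))  ≡⟨ inverse-▹-cancelʳ M detM≢0 _ ⟩
    T ▹ (M ▹ (M⁻¹ ▹ w))                ≡⟨ cong (T ▹_) (inverse-▹-cancelʳ M detM≢0 w) ⟩
    T ▹ w                              ∎)
    where open ≡-Reasoning

  upper : ℚ → ℚ → M2 ℚ
  upper x₁ x₂ = mat x₁ (U * ((x₂ - x₁) * inv V)) 0ℚ x₂

  MdiagM⁻¹≡upper : ∀ x₁ x₂ → M · diag x₁ x₂ · M⁻¹ ≡ upper x₁ x₂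
  MdiagM⁻¹≡upper x₁ x₂ = mat-≡
    (trans (solve 5 (λ x y u v w → (con 1ℚ :* x :+ u :* con 0ℚ) :* (w :* v) :+ (con 1ℚ :* con 0ℚ :+ u :* y) :* (w :* (:- con 0ℚ))
              := x :* (w :* v)) refl x₁ x₂ U V W′) (trans (cong (x₁ *_) W′*V≡1) (ℚP.*-identityʳ x₁)))
    (trans (solve 5 (λ x y u v w → (con 1ℚ :* x :+ u :* con 0ℚ) :* (w :* (:- u)) :+ (con 1ℚ :* con 0ℚ :+ u :* y) :* (w :* con 1ℚ)
              := u :* ((y :- x) :* w)) refl x₁ x₂ U V W′) (cong (λ w → U * ((x₂ - x₁) * w)) W′≡W))
    (solve 5 (λ x y u v w → (con 0ℚ :* x :+ v :* con 0ℚ) :* (w :* v) :+ (con 0ℚ :* con 0ℚ :+ v :* y) :* (w :* (:- con 0ℚ))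
              := con 0ℚ) refl x₁ x₂ U V W′)
    (trans (solve 5 (λ x y u v w → (con 0ℚ :* x :+ v :* con 0ℚ) :* (w :* (:- u)) :+ (con 0ℚ :* con 0ℚ :+ v :* y) :* (w :* con 1ℚ)
              := y :* (w :* v)) refl x₁ x₂ U V W′) (trans (cong (x₂ *_) W′*V≡1) (ℚP.*-identityʳ x₂)))
    where
    W′ : ℚ
    W′ = inv (det M)
    W′≡W : W′ ≡ inv V
    W′≡W = cong inv detM≡V
    W′*V≡1 : W′ * V ≡ 1ℚ
    W′*V≡1 = trans (cong (_* V) W′≡W) (inv-inverseˡ V (ι≢0 v≢0))

  Λ^-diag : ∀ K n x₁ x₂ z → Λ^ (K ℕ.+ n) (diag x₁ x₂ ▹ z) ≡ diag (L₁ ^ℚ K * x₁) (L₂ ^ℚ K * x₂) ▹ Λ^ n z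
  Λ^-diag K n x₁ x₂ (z₁ , z₂) = cong₂ _,_
    (trans (cong (_* (x₁ * z₁ + 0ℚ * z₂)) (^ℚ-+ L₁ K n))
      (solve 6 (λ a b x z w c → a :* b :* (x :* z :+ con 0ℚ :* w) := a :* x :* (b :* z) :+ con 0ℚ :* (c :* w))
         refl (L₁ ^ℚ K) (L₁ ^ℚ n) x₁ z₁ z₂ (L₂ ^ℚ n)))
    (trans (cong (_* (0ℚ * z₁ + x₂ * z₂)) (^ℚ-+ L₂ K n))
      (solve 6 (λ a b x z w c → a :* b :* (con 0ℚ :* w :+ x :* z) := con 0ℚ :* (c :* w) :+ a :* x :* (b :* z))
         refl (L₂ ^ℚ K) (L₂ ^ℚ n) x₂ z₂ z₁ (L₁ ^ℚ n)))

  M▹Λ^-diag : ∀ K n x₁ x₂ z → M ▹ Λ^ (K ℕ.+ n) (diag x₁ x₂ ▹ z) ≡ upper (L₁ ^ℚ K * x₁) (L₂ ^ℚ K * x₂) ▹ (M ▹ Λ^ n z)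
  M▹Λ^-diag K n x₁ x₂ z = begin
    M ▹ Λ^ (K ℕ.+ n) (diag x₁ x₂ ▹ z)     ≡⟨ cong (M ▹_) (Λ^-diag K n x₁ x₂ z) ⟩
    M ▹ (D ▹ Λ^ n z)                      ≡⟨ cong (λ t → M ▹ (D ▹ t)) (sym (inverse-▹-cancelˡ M detM≢0 (Λ^ n z))) ⟩
    M ▹ (D ▹ (M⁻¹ ▹ (M ▹ Λ^ n z)))        ≡⟨ sym (MXM⁻¹-▹ D (M ▹ Λ^ n z)) ⟩
    (M · D · M⁻¹) ▹ (M ▹ Λ^ n z)          ≡⟨ cong (_▹ (M ▹ Λ^ n z)) (MdiagM⁻¹≡upper (L₁ ^ℚ K * x₁) (L₂ ^ℚ K * x₂)) ⟩
    upper (L₁ ^ℚ K * x₁) (L₂ ^ℚ K * x₂) ▹ (M ▹ Λ^ n z) ∎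
    where
    open ≡-Reasoning
    D : M2 ℚ
    D = diag (L₁ ^ℚ K * x₁) (L₂ ^ℚ K * x₂)

  -- Equivalent to diag(x₁, x₂) preserving M⁻¹ G_A.
  Admissible : ℚ → ℚ → Set
  Admissible x₁ x₂ = ∃ λ K → Integral (L₁ ^ℚ K * x₁) × Integral (L₂ ^ℚ K * x₂) × L₁ ^ℚ K * x₁ ≡ L₂ ^ℚ K * x₂ [mod v ]

  integral-upper : ∀ {P Q} → Integral P → Integral Q → P ≡ Q [mod v ] → IntegralM (upper P Q)
  integral-upper iP iQ P≡Q =
    iP , integral-* (integral-ι u) (_≡_[mod_].quotient-integral (≡[mod]-sym P≡Q)) , integral-ι (+ 0) , iQ

  admissible⇒preserves : ∀ x₁ x₂ → Admissible x₁ x₂ → Preserves (diag x₁ x₂)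
  admissible⇒preserves x₁ x₂ (K , iP , iQ , P≡Q) z (n , int) =
    K ℕ.+ n , subst Integral² (sym (M▹Λ^-diag K n x₁ x₂ z)) (integralM-▹ _ _ (integral-upper iP iQ P≡Q) int)

  -- Test with e₁ and with M⁻¹e₂: the latter picks out the corner entry u(Q − P)/v of M·diag(P,Q)·M⁻¹.
  preserves⇒admissible : ∀ {α δ} → gcd u v ≡ + 1 → Preserves (diag α δ) → Admissible α δ
  preserves⇒admissible {α} {δ} gcd≡1 X-pres = N , iP , iQ , ≡[mod]-sym (coprime-cancel {u = u} gcd≡1 v≢0 iQ iP iU[Q-P]W)
    where
    e₁∈InGᴹ : InGᴹ (1ℚ , 0ℚ)
    e₁∈InGᴹ = 0 , integral-≡ (sym (solve 1 (λ u → con 1ℚ :* (con 1ℚ :* con 1ℚ) :+ u :* (con 1ℚ :* con 0ℚ) := con 1ℚ) refl U)) (integral-ι (+ 1))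
                , integral-≡ (sym (solve 1 (λ v → con 0ℚ :* (con 1ℚ :* con 1ℚ) :+ v :* (con 1ℚ :* con 0ℚ) := con 0ℚ) refl V)) (integral-ι (+ 0))
    M▹Λ^0M⁻¹e₂ : M ▹ Λ^ 0 (M⁻¹ ▹ (0ℚ , 1ℚ)) ≡ (0ℚ , 1ℚ)
    M▹Λ^0M⁻¹e₂ = trans (cong (M ▹_) (Λ^0 (M⁻¹ ▹ (0ℚ , 1ℚ)))) (inverse-▹-cancelʳ M detM≢0 (0ℚ , 1ℚ))
    X : M2 ℚ
    X = diag α δ
    n₁ : ℕ
    n₁ = proj₁ (X-pres (1ℚ , 0ℚ) e₁∈InGᴹ)
    iL₁ⁿ¹α : Integral (L₁ ^ℚ n₁ * α)
    iL₁ⁿ¹α = integral-≡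
      (solve 5 (λ P Q a d u → con 1ℚ :* (P :* (a :* con 1ℚ :+ con 0ℚ :* con 0ℚ)) :+ u :* (Q :* (con 0ℚ :* con 1ℚ :+ d :* con 0ℚ))
                 := P :* a) refl (L₁ ^ℚ n₁) (L₂ ^ℚ n₁) α δ U)
      (proj₁ (proj₂ (X-pres (1ℚ , 0ℚ) e₁∈InGᴹ)))
    z₀ : V2
    z₀ = M⁻¹ ▹ (0ℚ , 1ℚ)
    z₀∈ : InGᴹ z₀
    z₀∈ = 0 , subst Integral² (sym M▹Λ^0M⁻¹e₂) (integral-ι (+ 0) , integral-ι (+ 1))
    m N : ℕ
    m = proj₁ (X-pres z₀ z₀∈)
    N = n₁ ℕ.+ m
    P Q : ℚ
    P = L₁ ^ℚ N * α
    Q = L₂ ^ℚ N * δ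
    M▹Λ^N▹Xz₀ : M ▹ Λ^ N (X ▹ z₀) ≡ upper P Q ▹ (0ℚ , 1ℚ)
    M▹Λ^N▹Xz₀ = begin
      M ▹ Λ^ N (X ▹ z₀)             ≡⟨ cong (λ k → M ▹ Λ^ k (X ▹ z₀)) (sym (ℕP.+-identityʳ N)) ⟩
      M ▹ Λ^ (N ℕ.+ 0) (X ▹ z₀)     ≡⟨ M▹Λ^-diag N 0 α δ z₀ ⟩
      upper P Q ▹ (M ▹ Λ^ 0 z₀)     ≡⟨ cong (upper P Q ▹_) M▹Λ^0M⁻¹e₂ ⟩
      upper P Q ▹ (0ℚ , 1ℚ)         ∎
      where open ≡-Reasoning
    int : Integral² (upper P Q ▹ (0ℚ , 1ℚ))
    int = subst Integral² M▹Λ^N▹Xz₀ (InGᴹ-mono (X ▹ z₀) m n₁ (proj₂ (X-pres z₀ z₀∈)))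
    iQ : Integral Q
    iQ = integral-≡ (solve 1 (λ Q → con 0ℚ :* con 0ℚ :+ Q :* con 1ℚ := Q) refl Q) (proj₂ int)
    iU[Q-P]W : Integral (U * ((Q - P) * inv V))
    iU[Q-P]W = integral-≡ (solve 2 (λ P x → P :* con 0ℚ :+ x :* con 1ℚ := x) refl P (U * ((Q - P) * inv V))) (proj₁ int)
    iP : Integral P
    iP = integral-≡ (trans (solve 3 (λ a b x → b :* (a :* x) := a :* b :* x) refl (L₁ ^ℚ n₁) (L₁ ^ℚ m) α)
                           (cong (_* α) (sym (^ℚ-+ L₁ n₁ m))))
           (integral-* (integral-^ m (integral-ι l₁)) iL₁ⁿ¹α)

  L₁^≡L₂^ : v ℤD.∣ (l₁ ℤ.- l₂) → ∀ k → L₁ ^ℚ k ≡ L₂ ^ℚ k [mod v ]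
  L₁^≡L₂^ v∣l₁-l₂ k = ≡[mod]-^ k (integral-ι l₁) (integral-ι l₂) (∣⇒ι≡ι[mod] {a = l₁} {l₂} v≢0 v∣l₁-l₂)

  ι[l₁l₂]^ : ∀ k → ι (l₁ ℤ.* l₂) ^ℚ k ≡ L₁ ^ℚ k * L₂ ^ℚ k
  ι[l₁l₂]^ k = trans (cong (_^ℚ k) (ι-* l₁ l₂)) (^ℚ-distribʳ-* L₁ L₂ k)

  admissible⇒∈ : ∀ {x₁ x₂} → v ℤD.∣ (l₁ ℤ.- l₂) → Admissible x₁ x₂ →
                 x₁ ∈ℤ[1/ l₁ ] × x₂ ∈ℤ[1/ l₂ ] × (x₁ - x₂) * inv V ∈ℤ[1/ l₁ ℤ.* l₂ ]
  admissible⇒∈ {x₁} {x₂} v∣l₁-l₂ (K , iP , iQ , ≡[mod] i[P-Q]W) = scaled K iP , scaled K iQ ,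
    scaled K (integral-≡ eq (integral-+ (integral-* (integral-^ K (integral-ι l₂)) i[P-Q]W)
                                        (integral-* (_≡_[mod_].quotient-integral (≡[mod]-sym (L₁^≡L₂^ v∣l₁-l₂ K))) iQ)))
    where
    eq : L₂ ^ℚ K * ((L₁ ^ℚ K * x₁ - L₂ ^ℚ K * x₂) * inv V) + (L₂ ^ℚ K - L₁ ^ℚ K) * inv V * (L₂ ^ℚ K * x₂)
         ≡ ι (l₁ ℤ.* l₂) ^ℚ K * ((x₁ - x₂) * inv V)
    eq = trans (solve 5 (λ a b x y w → b :* ((a :* x :- b :* y) :* w) :+ (b :- a) :* w :* (b :* y) := a :* b :* ((x :- y) :* w))
                  refl (L₁ ^ℚ K) (L₂ ^ℚ K) x₁ x₂ (inv V))
               (cong (_* ((x₁ - x₂) * inv V)) (sym (ι[l₁l₂]^ K)))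

  ∈⇒admissible : ∀ {x₁ x₂} → v ℤD.∣ (l₁ ℤ.- l₂) →
                 x₁ ∈ℤ[1/ l₁ ] → x₂ ∈ℤ[1/ l₂ ] → (x₁ - x₂) * inv V ∈ℤ[1/ l₁ ℤ.* l₂ ] → Admissible x₁ x₂
  ∈⇒admissible {x₁} {x₂} v∣l₁-l₂ (scaled n₁ iL₁ⁿ¹x₁) (scaled n₂ iL₂ⁿ²x₂) (scaled m iDᵐ[x₁-x₂]W) =
    s ℕ.+ t , integral-≡ (sym P≡) (integral-* (integral-^ s (integral-ι l₁)) iA₁)
            , integral-≡ (sym Q≡) (integral-* (integral-^ t (integral-ι l₂)) iA₂) , P≡Q
    where
    s t : ℕ
    s = m ℕ.+ n₂
    t = m ℕ.+ n₁
    A₁ A₂ : ℚ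
    A₁ = L₁ ^ℚ t * x₁
    A₂ = L₂ ^ℚ s * x₂
    shift : ∀ L j n x → L ^ℚ (j ℕ.+ n) * x ≡ L ^ℚ j * (L ^ℚ n * x)
    shift L j n x = trans (cong (_* x) (^ℚ-+ L j n)) (ℚP.*-assoc (L ^ℚ j) (L ^ℚ n) x)
    iA₁ : Integral A₁
    iA₁ = integral-≡ (sym (shift L₁ m n₁ x₁)) (integral-* (integral-^ m (integral-ι l₁)) iL₁ⁿ¹x₁)
    iA₂ : Integral A₂
    iA₂ = integral-≡ (sym (shift L₂ m n₂ x₂)) (integral-* (integral-^ m (integral-ι l₂)) iL₂ⁿ²x₂)
    P≡ : L₁ ^ℚ (s ℕ.+ t) * x₁ ≡ L₁ ^ℚ s * A₁
    P≡ = shift L₁ s t x₁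
    Q≡ : L₂ ^ℚ (s ℕ.+ t) * x₂ ≡ L₂ ^ℚ t * A₂
    Q≡ = trans (cong (λ k → L₂ ^ℚ k * x₂) (ℕP.+-comm s t)) (shift L₂ t s x₂)
    middle : L₂ ^ℚ s * A₁ ≡ L₁ ^ℚ t * A₂ [mod v ]
    middle = ≡[mod] (integral-≡ (sym eq) (integral-* (integral-* (integral-^ n₁ (integral-ι l₁)) (integral-^ n₂ (integral-ι l₂))) iDᵐ[x₁-x₂]W))
      where
      eq : (L₂ ^ℚ s * A₁ - L₁ ^ℚ t * A₂) * inv V ≡ L₁ ^ℚ n₁ * L₂ ^ℚ n₂ * (ι (l₁ ℤ.* l₂) ^ℚ m * ((x₁ - x₂) * inv V))
      eq = begin
        (L₂ ^ℚ s * (L₁ ^ℚ t * x₁) - L₁ ^ℚ t * (L₂ ^ℚ s * x₂)) * inv V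
          ≡⟨ cong₂ (λ a b → (a * (b * x₁) - b * (a * x₂)) * inv V) (^ℚ-+ L₂ m n₂) (^ℚ-+ L₁ m n₁) ⟩
        (L₂ ^ℚ m * L₂ ^ℚ n₂ * (L₁ ^ℚ m * L₁ ^ℚ n₁ * x₁) - L₁ ^ℚ m * L₁ ^ℚ n₁ * (L₂ ^ℚ m * L₂ ^ℚ n₂ * x₂)) * inv V
          ≡⟨ solve 7 (λ a b c d x y w → (a :* b :* (c :* d :* x) :- c :* d :* (a :* b :* y)) :* w := d :* b :* (c :* a :* ((x :- y) :* w)))
               refl (L₂ ^ℚ m) (L₂ ^ℚ n₂) (L₁ ^ℚ m) (L₁ ^ℚ n₁) x₁ x₂ (inv V) ⟩
        L₁ ^ℚ n₁ * L₂ ^ℚ n₂ * (L₁ ^ℚ m * L₂ ^ℚ m * ((x₁ - x₂) * inv V))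
          ≡⟨ cong (λ D → L₁ ^ℚ n₁ * L₂ ^ℚ n₂ * (D * ((x₁ - x₂) * inv V))) (sym (ι[l₁l₂]^ m)) ⟩
        L₁ ^ℚ n₁ * L₂ ^ℚ n₂ * (ι (l₁ ℤ.* l₂) ^ℚ m * ((x₁ - x₂) * inv V)) ∎
        where open ≡-Reasoning
    P≡Q : L₁ ^ℚ (s ℕ.+ t) * x₁ ≡ L₂ ^ℚ (s ℕ.+ t) * x₂ [mod v ]
    P≡Q = begin
      L₁ ^ℚ (s ℕ.+ t) * x₁   ≡⟨ P≡ ⟩
      L₁ ^ℚ s * A₁           ∼⟨ ≡[mod]-*ʳ iA₁ (L₁^≡L₂^ v∣l₁-l₂ s) ⟩
      L₂ ^ℚ s * A₁           ∼⟨ middle ⟩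
      L₁ ^ℚ t * A₂           ∼⟨ ≡[mod]-*ʳ iA₂ (L₁^≡L₂^ v∣l₁-l₂ t) ⟩
      L₂ ^ℚ t * A₂           ≡⟨ sym Q≡ ⟩
      L₂ ^ℚ (s ℕ.+ t) * x₂   ∎
      where open ≡[mod]-Reasoning

  -- M Λᵏ (l₁⁻ᵏ, 0) = e₁, so the second coordinate of the image forces v·l₂ⁿ·γ/l₁ᵏ ∈ ℤ for every k.
  preserves⇒lower-left≡0 : ∀ {p} α β γ δ → Prime p → p ∣ ℤ.∣ l₁ ∣ → ¬ p ∣ ℤ.∣ l₂ ∣ → Preserves (mat α β γ δ) → γ ≡ 0ℚ
  preserves⇒lower-left≡0 α β γ δ p-prime p∣l₁ p∤l₂ X-pres =
    ≡0-if-divisible-by-all-powers p-prime {l′ = l₂} p∣l₁ p∤l₂ v≢0 l₁≢0 γ λ k → divisible k (X-pres (z k) (z∈ k))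
    where
    I : ℚ
    I = inv L₁
    z : ℕ → V2
    z k = (I ^ℚ k , 0ℚ)
    z∈ : ∀ k → InGᴹ (z k)
    z∈ k = k , integral-≡ (sym (trans (solve 4 (λ a b u c → con 1ℚ :* (a :* b) :+ u :* (c :* con 0ℚ) := a :* b) refl (L₁ ^ℚ k) (I ^ℚ k) U (L₂ ^ℚ k))
                                      (^ℚ-inverseʳ L₁ k (ι≢0 l₁≢0)))) (integral-ι (+ 1))
             , integral-≡ (sym (solve 4 (λ a b v c → con 0ℚ :* (a :* b) :+ v :* (c :* con 0ℚ) := con 0ℚ) refl (L₁ ^ℚ k) (I ^ℚ k) V (L₂ ^ℚ k))) (integral-ι (+ 0))
    divisible : ∀ k → InGᴹ (mat α β γ δ ▹ z k) → ∃ λ n → Integral (V * L₂ ^ℚ n * γ * I ^ℚ k)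
    divisible k (n , _ , int) = n , integral-≡
      (solve 8 (λ P Q a b c d y v → con 0ℚ :* (P :* (a :* y :+ b :* con 0ℚ)) :+ v :* (Q :* (c :* y :+ d :* con 0ℚ))
                   := v :* Q :* c :* y) refl (L₁ ^ℚ n) (L₂ ^ℚ n) α β γ δ (I ^ℚ k) V) int

  -- M Λᵏ (0, l₂⁻ᵏ) = (u, v); combining the two coordinates of the image isolates v·l₁ⁿ·β/l₂ᵏ.
  preserves⇒upper-right≡0 : ∀ {q} α β γ δ → Prime q → q ∣ ℤ.∣ l₂ ∣ → ¬ q ∣ ℤ.∣ l₁ ∣ → Preserves (mat α β γ δ) → β ≡ 0ℚ
  preserves⇒upper-right≡0 α β γ δ q-prime q∣l₂ q∤l₁ X-pres =
    ≡0-if-divisible-by-all-powers q-prime {l′ = l₁} q∣l₂ q∤l₁ v≢0 l₂≢0 β λ k → divisible k (X-pres (z k) (z∈ k))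
    where
    I : ℚ
    I = inv L₂
    z : ℕ → V2
    z k = (0ℚ , I ^ℚ k)
    LᵏIᵏ≡1 : ∀ k → L₂ ^ℚ k * I ^ℚ k ≡ 1ℚ
    LᵏIᵏ≡1 k = ^ℚ-inverseʳ L₂ k (ι≢0 l₂≢0)
    z∈ : ∀ k → InGᴹ (z k)
    z∈ k = k , integral-≡ (sym (trans (solve 4 (λ a b u c → con 1ℚ :* (c :* con 0ℚ) :+ u :* (a :* b) := u :* (a :* b)) refl (L₂ ^ℚ k) (I ^ℚ k) U (L₁ ^ℚ k))
                                      (trans (cong (U *_) (LᵏIᵏ≡1 k)) (ℚP.*-identityʳ U)))) (integral-ι u)
             , integral-≡ (sym (trans (solve 4 (λ a b v c → con 0ℚ :* (c :* con 0ℚ) :+ v :* (a :* b) := v :* (a :* b)) refl (L₂ ^ℚ k) (I ^ℚ k) V (L₁ ^ℚ k))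
                                      (trans (cong (V *_) (LᵏIᵏ≡1 k)) (ℚP.*-identityʳ V)))) (integral-ι v)
    divisible : ∀ k → InGᴹ (mat α β γ δ ▹ z k) → ∃ λ n → Integral (V * L₁ ^ℚ n * β * I ^ℚ k)
    divisible k (n , int₁ , int₂) = n , integral-≡
      (solve 9 (λ P Q a b c d y v u →
           v :* (con 1ℚ :* (P :* (a :* con 0ℚ :+ b :* y)) :+ u :* (Q :* (c :* con 0ℚ :+ d :* y)))
           :- u :* (con 0ℚ :* (P :* (a :* con 0ℚ :+ b :* y)) :+ v :* (Q :* (c :* con 0ℚ :+ d :* y)))
             := v :* P :* b :* y) refl (L₁ ^ℚ n) (L₂ ^ℚ n) α β γ δ (I ^ℚ k) V U)
      (integral-- (integral-* (integral-ι v) int₁) (integral-* (integral-ι u) int₂))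

  upper-comm : ∀ x₁ x₂ y₁ y₂ → upper x₁ x₂ · upper y₁ y₂ ≡ upper y₁ y₂ · upper x₁ x₂
  upper-comm x₁ x₂ y₁ y₂ = mat-≡
    (solve 6 (λ a b c d u w → a :* c :+ u :* ((b :- a) :* w) :* con 0ℚ := c :* a :+ u :* ((d :- c) :* w) :* con 0ℚ) refl x₁ x₂ y₁ y₂ U (inv V))
    (solve 6 (λ a b c d u w → a :* (u :* ((d :- c) :* w)) :+ u :* ((b :- a) :* w) :* d := c :* (u :* ((b :- a) :* w)) :+ u :* ((d :- c) :* w) :* b) refl x₁ x₂ y₁ y₂ U (inv V))
    (solve 6 (λ a b c d u w → con 0ℚ :* c :+ b :* con 0ℚ := con 0ℚ :* a :+ d :* con 0ℚ) refl x₁ x₂ y₁ y₂ U (inv V))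
    (solve 6 (λ a b c d u w → con 0ℚ :* (u :* ((d :- c) :* w)) :+ b :* d := con 0ℚ :* (u :* ((b :- a) :* w)) :+ d :* b) refl x₁ x₂ y₁ y₂ U (inv V))

-- The endomorphism ring

module Endomorphisms (l₁ l₂ u v : ℤ) (A : M2 ℤ)
  (gcd≡1 : gcd u v ≡ + 1)
  (v∣l₁-l₂ : v ℤD.∣ (l₁ ℤ.- l₂))
  (v≢0 : v ≢ + 0)
  (A≡MΛM⁻¹ : mapM ι A ≡ Mmat u v · diag (ι l₁) (ι l₂) · inverse (Mmat u v))
  (detA≢0 : detℤ A ≢ + 0)
  (rad₁∤rad₂ : ¬ (rad l₁ ∣ rad l₂))
  (rad₂∤rad₁ : ¬ (rad l₂ ∣ rad l₁)) where

  open Eigenbasis l₁ l₂ u v A v≢0 A≡MΛM⁻¹ detA≢0 public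

  isEnd⇒admissible : ∀ T → IsEnd A T → ∃₂ λ x₁ x₂ → Admissible x₁ x₂ × T ≡ M · diag x₁ x₂ · M⁻¹
  isEnd⇒admissible T T-end = M2.a X , M2.d X , preserves⇒admissible gcd≡1 (subst Preserves X≡diag X-pres)
                           , trans (≡MM⁻¹TMM⁻¹ T) (cong (λ Y → M · Y · M⁻¹) X≡diag)
    where
    X : M2 ℚ
    X = M⁻¹ · T · M
    X-pres : Preserves X
    X-pres = IsEnd⇒Preserves T T-end
    X≡diag : X ≡ diag (M2.a X) (M2.d X)
    X≡diag = mat-≡ refl upper-right≡0 lower-left≡0 refl
      where
      upper-right≡0 : M2.b X ≡ 0ℚ
      upper-right≡0 = let (_ , q-prime , q∣l₂ , q∤l₁) = rad∤rad⇒prime l₂ l₁ l₁≢0 rad₂∤rad₁ in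
                      preserves⇒upper-right≡0 (M2.a X) (M2.b X) (M2.c X) (M2.d X) q-prime q∣l₂ q∤l₁ X-pres
      lower-left≡0 : M2.c X ≡ 0ℚ
      lower-left≡0 = let (_ , p-prime , p∣l₁ , p∤l₂) = rad∤rad⇒prime l₁ l₂ l₂≢0 rad₁∤rad₂ in
                      preserves⇒lower-left≡0 (M2.a X) (M2.b X) (M2.c X) (M2.d X) p-prime p∣l₁ p∤l₂ X-pres

  ∈R⇒InR : ∀ {x} → x ∈ℤ[1/ l₁ ℤ.* l₂ ] → InR A x
  ∈R⇒InR x∈ = subst (λ m → Zinv m _) (sym detA≡l₁l₂) (∈ℤ[1/]⇒Zinv l₁l₂≢0 x∈)

  InR⇒∈R : ∀ {x} → InR A x → x ∈ℤ[1/ l₁ ℤ.* l₂ ]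
  InR⇒∈R x∈ = Zinv⇒∈ℤ[1/] l₁l₂≢0 (subst (λ m → Zinv m _) detA≡l₁l₂ x∈)

  Characterised : M2 ℚ → Set
  Characterised T = ∃₂ λ (x₁ x₂ : ℚ) → Zinv l₁ x₁ × Zinv l₂ x₂ × InR A ((x₁ - x₂) * inv (ι v)) × T ≡ M · diag x₁ x₂ · M⁻¹

  isEnd⇒characterised : ∀ T → IsEnd A T → Characterised T
  isEnd⇒characterised T T-end =
    let (x₁ , x₂ , adm , T≡) = isEnd⇒admissible T T-end
        (x₁∈ , x₂∈ , [x₁-x₂]W∈) = admissible⇒∈ v∣l₁-l₂ adm
    in x₁ , x₂ , ∈ℤ[1/]⇒Zinv l₁≢0 x₁∈ , ∈ℤ[1/]⇒Zinv l₂≢0 x₂∈ , ∈R⇒InR [x₁-x₂]W∈ , T≡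

  characterised⇒isEnd : ∀ T → Characterised T → IsEnd A T
  characterised⇒isEnd T (x₁ , x₂ , x₁∈ , x₂∈ , [x₁-x₂]W∈ , refl) = Preserves⇒IsEnd (diag x₁ x₂) (admissible⇒preserves x₁ x₂
    (∈⇒admissible v∣l₁-l₂ (Zinv⇒∈ℤ[1/] l₁≢0 x₁∈) (Zinv⇒∈ℤ[1/] l₂≢0 x₂∈) (InR⇒∈R [x₁-x₂]W∈)))

  isEnd⇔characterised : ∀ T → IsEnd A T ⇔ Characterised T
  isEnd⇔characterised T = mk⇔ (isEnd⇒characterised T) (characterised⇒isEnd T)

  characterised⇒≡upper : ∀ {T} → Characterised T → T ≡ upper (M2.a T) (M2.d T)
  characterised⇒≡upper (x₁ , x₂ , _ , _ , _ , T≡) =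
    let T≡upper = trans T≡ (MdiagM⁻¹≡upper x₁ x₂) in
    trans T≡upper (cong₂ upper (sym (cong M2.a T≡upper)) (sym (cong M2.d T≡upper)))

  isEnd⇒≡upper : ∀ T → IsEnd A T → T ≡ upper (M2.a T) (M2.d T)
  isEnd⇒≡upper T T-end = characterised⇒≡upper (isEnd⇒characterised T T-end)

  isEnd⇒admissible-diagonal : ∀ T → IsEnd A T → Admissible (M2.a T) (M2.d T)
  isEnd⇒admissible-diagonal T T-end =
    let (x₁ , x₂ , adm , T≡) = isEnd⇒admissible T T-end
        T≡upper = trans T≡ (MdiagM⁻¹≡upper x₁ x₂)
    in subst₂ Admissible (sym (cong M2.a T≡upper)) (sym (cong M2.d T≡upper)) adm

  isEnd⇒diagonal∈ : ∀ T → IsEnd A T →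
    M2.a T ∈ℤ[1/ l₁ ] × M2.d T ∈ℤ[1/ l₂ ] × (M2.a T - M2.d T) * inv V ∈ℤ[1/ l₁ ℤ.* l₂ ]
  isEnd⇒diagonal∈ T T-end = admissible⇒∈ v∣l₁-l₂ (isEnd⇒admissible-diagonal T T-end)

  isEnd⇒diagonal-Zinv : ∀ T → IsEnd A T → Zinv l₁ (M2.a T) × Zinv l₂ (M2.d T)
  isEnd⇒diagonal-Zinv T T-end = let (a∈ , d∈ , _) = isEnd⇒diagonal∈ T T-end in
    ∈ℤ[1/]⇒Zinv l₁≢0 a∈ , ∈ℤ[1/]⇒Zinv l₂≢0 d∈

  isEnd-comm : ∀ T S → IsEnd A T → IsEnd A S → T · S ≡ S · T
  isEnd-comm T S T-end S-end = begin
    T · S                                                     ≡⟨ cong₂ _·_ (isEnd⇒≡upper T T-end) (isEnd⇒≡upper S S-end) ⟩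
    upper (M2.a T) (M2.d T) · upper (M2.a S) (M2.d S)         ≡⟨ upper-comm (M2.a T) (M2.d T) (M2.a S) (M2.d S) ⟩
    upper (M2.a S) (M2.d S) · upper (M2.a T) (M2.d T)         ≡⟨ sym (cong₂ _·_ (isEnd⇒≡upper S S-end) (isEnd⇒≡upper T T-end)) ⟩
    S · T                                                     ∎
    where open ≡-Reasoning

  diagonal : M2 ℚ → ℚ × ℚ
  diagonal T = (M2.a T , M2.d T)

  diagonal-· : ∀ T S → IsEnd A T → IsEnd A S → diagonal (T · S) ≡ (M2.a T * M2.a S , M2.d T * M2.d S)
  diagonal-· T S T-end S-end = cong₂ _,_
    (trans (cong (λ c → M2.a T * M2.a S + M2.b T * c) (cong M2.c (isEnd⇒≡upper S S-end)))
           (solve 3 (λ x y b → x :* y :+ b :* con 0ℚ := x :* y) refl (M2.a T) (M2.a S) (M2.b T)))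
    (trans (cong (λ c → c * M2.b S + M2.d T * M2.d S) (cong M2.c (isEnd⇒≡upper T T-end)))
           (solve 3 (λ x y b → con 0ℚ :* b :+ x :* y := x :* y) refl (M2.d T) (M2.d S) (M2.b S)))

  diagonal-injective : ∀ T S → IsEnd A T → IsEnd A S → diagonal T ≡ diagonal S → T ≡ S
  diagonal-injective T S T-end S-end eq =
    trans (isEnd⇒≡upper T T-end) (trans (cong₂ upper (cong proj₁ eq) (cong proj₂ eq)) (sym (isEnd⇒≡upper S S-end)))

  isEnd⇒centralises : ∀ T → IsEnd A T → T · A′ ≡ A′ · T
  isEnd⇒centralises T T-end = begin
    T · A′                                  ≡⟨ cong₂ _·_ (isEnd⇒≡upper T T-end) A′≡upper ⟩
    upper (M2.a T) (M2.d T) · upper L₁ L₂    ≡⟨ upper-comm (M2.a T) (M2.d T) L₁ L₂ ⟩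
    upper L₁ L₂ · upper (M2.a T) (M2.d T)    ≡⟨ sym (cong₂ _·_ A′≡upper (isEnd⇒≡upper T T-end)) ⟩
    A′ · T                                  ∎
    where
    open ≡-Reasoning
    A′≡upper : A′ ≡ upper L₁ L₂
    A′≡upper = trans A≡MΛM⁻¹ (MdiagM⁻¹≡upper L₁ L₂)

  isEnd⇒entries∈R : ∀ T → IsEnd A T → InR A (M2.a T) × InR A (M2.b T) × InR A (M2.c T) × InR A (M2.d T)
  isEnd⇒entries∈R T T-end =
      ∈R⇒InR (∈ℤ[1/]-⊆-* l₂ a∈)
    , ∈R⇒InR (subst (_∈ℤ[1/ l₁ ℤ.* l₂ ]) (sym b≡) (∈ℤ[1/]-*ˡ (integral-ι u) (∈ℤ[1/]-neg [a-d]W∈)))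
    , ∈R⇒InR (integral⇒∈ℤ[1/] (integral-≡ (sym (cong M2.c T≡upper)) (integral-ι (+ 0))))
    , ∈R⇒InR (subst (λ m → M2.d T ∈ℤ[1/ m ]) (ℤP.*-comm l₂ l₁) (∈ℤ[1/]-⊆-* l₁ d∈))
    where
    T≡upper : T ≡ upper (M2.a T) (M2.d T)
    T≡upper = isEnd⇒≡upper T T-end
    a∈ : M2.a T ∈ℤ[1/ l₁ ]
    a∈ = proj₁ (isEnd⇒diagonal∈ T T-end)
    d∈ : M2.d T ∈ℤ[1/ l₂ ]
    d∈ = proj₁ (proj₂ (isEnd⇒diagonal∈ T T-end))
    [a-d]W∈ : (M2.a T - M2.d T) * inv V ∈ℤ[1/ l₁ ℤ.* l₂ ]
    [a-d]W∈ = proj₂ (proj₂ (isEnd⇒diagonal∈ T T-end))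
    b≡ : M2.b T ≡ U * - ((M2.a T - M2.d T) * inv V)
    b≡ = trans (cong M2.b T≡upper)
      (solve 4 (λ u a d w → u :* ((d :- a) :* w) := u :* (:- ((a :- d) :* w))) refl U (M2.a T) (M2.d T) (inv V))


theorem3p6 : (l₁ l₂ u v : ℤ) (A : M2 ℤ) →
  gcd u v ≡ + 1 →
  v ℤD.∣ (l₁ ℤ.- l₂) →
  v ≢ + 0 →
  mapM ι A ≡ Mmat u v · diag (ι l₁) (ι l₂) · inverse (Mmat u v) →
  detℤ A ≢ + 0 →
  ∃ (InP' A) →
  ¬ (rad l₁ ∣ rad l₂) →
  ¬ (rad l₂ ∣ rad l₁) →
  (∀ (T : M2 ℚ) → IsEnd A T ⇔
      (∃₂ λ (x₁ x₂ : ℚ) → Zinv l₁ x₁ × Zinv l₂ x₂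
        × InR A ((x₁ - x₂) * inv (ι v))
        × T ≡ Mmat u v · diag x₁ x₂ · inverse (Mmat u v)))
  × (∀ (T S : M2 ℚ) → IsEnd A T → IsEnd A S → T · S ≡ S · T)
  × (∃ λ (φ : M2 ℚ → ℚ × ℚ) →
      (∀ T → IsEnd A T → Zinv l₁ (proj₁ (φ T)) × Zinv l₂ (proj₂ (φ T)))
      × (∀ T S → IsEnd A T → IsEnd A S →
           φ (T ⊕ S) ≡ (proj₁ (φ T) + proj₁ (φ S) , proj₂ (φ T) + proj₂ (φ S)))
      × (∀ T S → IsEnd A T → IsEnd A S →
           φ (T · S) ≡ (proj₁ (φ T) * proj₁ (φ S) , proj₂ (φ T) * proj₂ (φ S)))
      × (φ I₂ ≡ (1ℚ , 1ℚ))
      × (∀ T S → IsEnd A T → IsEnd A S → φ T ≡ φ S → T ≡ S))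
  × (∀ T → IsEnd A T →
      (T · mapM ι A ≡ mapM ι A · T)
      × InR A (M2.a T) × InR A (M2.b T) × InR A (M2.c T) × InR A (M2.d T))
theorem3p6 l₁ l₂ u v A gcd≡1 v∣l₁-l₂ v≢0 A≡MΛM⁻¹ detA≢0 _ rad₁∤rad₂ rad₂∤rad₁ =
    isEnd⇔characterised
  , isEnd-comm
  , (diagonal , isEnd⇒diagonal-Zinv , (λ _ _ _ _ → refl) , diagonal-· , refl , diagonal-injective)
  , λ T T-end → isEnd⇒centralises T T-end , isEnd⇒entries∈R T T-end
  where open Endomorphisms l₁ l₂ u v A gcd≡1 v∣l₁-l₂ v≢0 A≡MΛM⁻¹ detA≢0 rad₁∤rad₂ rad₂∤rad₁
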